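{- Let $r=r(n)$ be positive integers with $r=o(n^{3/8})$ as $n\to\infty$. In the random intersecting process on $\binom{[n]}{r}$ (described in the context), let $\mathcal{A}_4$ be the event that $\{e_1,e_2,e_3,e_4\}$ is a $4$-star, and let $\mathcal{B}_{3r}$ be the event that $\bigcap_{j=1}^{3r}e_j\neq\emptyset$. Then $\Pr(\mathcal{B}_{3r}\mid\mathcal{A}_4)=1-o(1)$.
   Context: Random intersecting process: choose $e_1$ uniformly at random from $\binom{[n]}{r}$ (the $r$-subsets of $[n]=\{1,\dots,n\}$); given $\mathcal{F}_i=\{e_1,\ldots,e_i\}$, let $\mathcal{A}(\mathcal{F}_i)$ be the set of all $e\in\binom{[n]}{r}$, $e\notin\mathcal{F}_i$, with $e\cap e_j\ne\emptyset$ for all $j\le i$; choose $e_{i+1}$ uniformly at random from $\mathcal{A}(\mathcal{F}_i)$, halting when $\mathcal{A}(\mathcal{F}_i)=\emptyset$. A star is a collection of sets such that every pair in the collection has the same one-element intersection $\{x\}$ (the kernel); a star with $i\ge2$ sets is an $i$-star. -}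

module Defs where

open import Data.Bool using (Bool; true; false; _∧_; if_then_else_; not)
open import Data.Nat as ℕ using (ℕ; zero; suc)
open import Data.Integer using (+_)
open import Data.Fin using (Fin)
open import Data.Fin.Subset using (Subset; inside; outside; _∩_; ∣_∣; ⁅_⁆; ⊤)
open import Data.Fin.Subset.Properties using (nonempty?)
open import Data.Vec using ([]; _∷_)
open import Data.Vec.Properties using (≡-dec)
import Data.Bool.Properties as BP
open import Data.List using (List; []; _∷_; map; _++_; filter; length; foldr; take; allFin; [_])
open import Data.Bool.ListAction using (all; any)
open import Data.Rational using (ℚ; 0ℚ; 1ℚ; _+_; _*_; _/_)
open import Relation.Nullary.Decidable using (⌊_⌋)

allSubsets : (n : ℕ) → List (Subset n)
allSubsets zero = [ [] ]
allSubsets (suc n) = map (outside ∷_) (allSubsets n) ++ map (inside ∷_) (allSubsets n)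

rSets : (n r : ℕ) → List (Subset n)
rSets n r = filter (λ s → ∣ s ∣ ℕ.≟ r) (allSubsets n)

_==_ : {n : ℕ} → Subset n → Subset n → Bool
s == t = ⌊ ≡-dec BP._≟_ s t ⌋

meets : {n : ℕ} → Subset n → Subset n → Bool
meets s t = ⌊ nonempty? (s ∩ t) ⌋

admissible : (n r : ℕ) → List (Subset n) → List (Subset n)
admissible n r F =
  filter (λ e → Data.Bool.T? (not (any (e ==_) F) ∧ all (meets e) F)) (rSets n r)
  where import Data.Bool

-- Probability (exact, in ℚ) that the random intersecting process on ([n] choose r),
-- started from the already-chosen sequence F (in order e₁,…), makes k further steps
-- (i.e. does not halt before) and the resulting sequence satisfies P.
runProb : (n r : ℕ) → ℕ → List (Subset n) → (List (Subset n) → Bool) → ℚ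
runProb n r zero    F P = if P F then 1ℚ else 0ℚ
runProb n r (suc k) F P with admissible n r F
... | []           = 0ℚ
... | A@(_ ∷ A')   =
  ((+ 1) / suc (length A')) * foldr (λ e acc → runProb n r k (F ++ [ e ]) P + acc) 0ℚ A

Pr : (n r k : ℕ) → (List (Subset n) → Bool) → ℚ
Pr n r k P = runProb n r k [] P

pairsOK : {n : ℕ} → (Subset n → Subset n → Bool) → List (Subset n) → Bool
pairsOK R [] = true
pairsOK R (s ∷ ss) = all (R s) ss ∧ pairsOK R ss

isStar : {n : ℕ} → List (Subset n) → Bool
isStar {n} F = any (λ x → pairsOK (λ s t → (s ∩ t) == ⁅ x ⁆) F) (allFin n)

A4 : {n : ℕ} → List (Subset n) → Bool
A4 F = isStar (take 4 F)

B : {n : ℕ} → ℕ → List (Subset n) → Bool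
B m F = ⌊ nonempty? (foldr _∩_ ⊤ (take m F)) ⌋

toℚ : ℕ → ℚ
toℚ m = (+ m) / 1

module Submission where

-- Condition on e₁,…,e₄ forming a star with kernel x. While every chosen set
-- contains x, an admissible set avoiding x must meet the four star members at
-- four distinct points other than x, so there are at most r⁴·C(n−4, r−4) of
-- them, against at least C(n−1, r−1) − O(r) admissible sets through x. Hence
-- each step leaves the kernel with probability O(r⁷/n³), and a union bound over
-- the at most 3r further steps keeps all of e₁,…,e₃ᵣ through x with probability
-- 1 − O(r⁸/n³) = 1 − o(1).

module Counting where

  open import Data.Bool using (Bool; true; false; _∧_; not; if_then_else_; T)
  open import Data.Empty using (⊥; ⊥-elim)
  open import Data.List using (List; []; _∷_; _++_; length; map; filter)
  open import Data.List.Membership.Propositional using () renaming (_∈_ to _∈ˡ_)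
  open import Data.List.Relation.Unary.Any using (Any; here; there)
  open import Data.Nat using (ℕ; suc; _≤_; _+_; _*_; z≤n; s≤s)
  import Data.Nat.Properties as ℕ
  open import Function using (_∘′_)
  open import Level using (0ℓ)
  open import Relation.Binary.PropositionalEquality using (_≡_; refl; sym; trans; cong)
  open import Relation.Nullary using (does)
  open import Relation.Unary using (Pred; Decidable)

  T-∧⁺ : ∀ {a b} → T a → T b → T (a ∧ b)
  T-∧⁺ {true} _ tb = tb

  T-∧⁻ˡ : ∀ {a b} → T (a ∧ b) → T a
  T-∧⁻ˡ {true} _ = _

  T-∧⁻ʳ : ∀ {a b} → T (a ∧ b) → T b
  T-∧⁻ʳ {true} tb = tb

  T-not⇒¬T : ∀ {a} → T (not a) → T a → ⊥
  T-not⇒¬T {false} _ ()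

  count : {A : Set} → (A → Bool) → List A → ℕ
  count p []       = 0
  count p (x ∷ xs) = if p x then suc (count p xs) else count p xs

  module _ {A : Set} where

    count-filter : {P : Pred A 0ℓ} (P? : Decidable P) (p : A → Bool) (xs : List A) →
                   count p (filter P? xs) ≡ count (λ e → does (P? e) ∧ p e) xs
    count-filter P? p [] = refl
    count-filter P? p (x ∷ xs) with does (P? x)
    ... | false = count-filter P? p xs
    ... | true with p x
    ...   | true  = cong suc (count-filter P? p xs)
    ...   | false = count-filter P? p xs

    count-++ : (p : A → Bool) (xs ys : List A) → count p (xs ++ ys) ≡ count p xs + count p ys
    count-++ p []       ys = refl
    count-++ p (x ∷ xs) ys with p x
    ... | true  = cong suc (count-++ p xs ys)
    ... | false = count-++ p xs ys

    count-map : {B : Set} (p : B → Bool) (f : A → B) (xs : List A) →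
                count p (map f xs) ≡ count (λ e → p (f e)) xs
    count-map p f []       = refl
    count-map p f (x ∷ xs) with p (f x)
    ... | true  = cong suc (count-map p f xs)
    ... | false = count-map p f xs

    count-cong : {p q : A → Bool} (xs : List A) → (∀ e → p e ≡ q e) → count p xs ≡ count q xs
    count-cong []                 p≡q = refl
    count-cong {p} {q} (x ∷ xs) p≡q with p x | q x | p≡q x
    ... | true  | true  | refl = cong suc (count-cong xs p≡q)
    ... | false | false | refl = count-cong xs p≡q

    count-mono : {p q : A → Bool} (xs : List A) → (∀ {e} → T (p e) → T (q e)) → count p xs ≤ count q xs
    count-mono []                 p⇒q = z≤n
    count-mono {p} {q} (x ∷ xs) p⇒q with p x | q x | p⇒q {x}
    ... | true  | true  | _   = s≤s (count-mono xs p⇒q)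
    ... | true  | false | px⇒ = ⊥-elim (px⇒ _)
    ... | false | true  | _   = ℕ.m≤n⇒m≤1+n (count-mono xs p⇒q)
    ... | false | false | _   = count-mono xs p⇒q

    count-false : {p : A → Bool} (xs : List A) → (∀ e → p e ≡ false) → count p xs ≡ 0
    count-false []           _         = refl
    count-false {p} (x ∷ xs) px≡false with p x | px≡false x
    ... | false | refl = count-false xs px≡false

    count-true : (xs : List A) → count (λ _ → true) xs ≡ length xs
    count-true []       = refl
    count-true (x ∷ xs) = cong suc (count-true xs)

    count-≤-length : (p : A → Bool) (xs : List A) → count p xs ≤ length xs
    count-≤-length p xs = ℕ.≤-trans (count-mono xs (λ _ → _)) (ℕ.≤-reflexive (count-true xs))

    count-∧-split : (p q : A → Bool) (xs : List A) →
      count p xs ≡ count (λ e → p e ∧ q e) xs + count (λ e → p e ∧ not (q e)) xs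
    count-∧-split p q [] = refl
    count-∧-split p q (x ∷ xs) with p x
    ... | false = count-∧-split p q xs
    ... | true with q x
    ...   | true  = cong suc (count-∧-split p q xs)
    ...   | false = trans (cong suc (count-∧-split p q xs)) (sym (ℕ.+-suc _ _))

    length≡count+count-not : (p : A → Bool) (xs : List A) → length xs ≡ count p xs + count (not ∘′ p) xs
    length≡count+count-not p xs = trans (sym (count-true xs)) (count-∧-split (λ _ → true) p xs)

    union-bound : {B : Set} (P : A → Bool) (Q : B → A → Bool) (xs : List A) (Ys : List B) (b : ℕ) →
      (∀ {e} → T (P e) → Any (λ y → T (Q y e)) Ys) →
      (∀ {y} → y ∈ˡ Ys → count (λ e → P e ∧ Q y e) xs ≤ b) →
      count P xs ≤ length Ys * b
    union-bound P Q xs [] b covered bounded =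
      ℕ.≤-trans (count-mono xs (λ Pe → uncovered (covered Pe))) (ℕ.≤-reflexive (count-false {p = λ _ → false} xs (λ _ → refl)))
      where
      uncovered : ∀ {e} → Any (λ y → T (Q y e)) [] → T false
      uncovered ()
    union-bound P Q xs (y ∷ Ys) b covered bounded = begin
      count P xs                                                        ≡⟨ count-∧-split P (Q y) xs ⟩
      count (λ e → P e ∧ Q y e) xs + count (λ e → P e ∧ not (Q y e)) xs ≤⟨ ℕ.+-mono-≤ (bounded (here refl)) rest ⟩
      b + length Ys * b                                                 ∎
      where
      open ℕ.≤-Reasoning
      covered′ : ∀ {e} → T (P e ∧ not (Q y e)) → Any (λ y → T (Q y e)) Ys
      covered′ {e} h with covered (T-∧⁻ˡ {P e} h)
      ... | here  Qye   = ⊥-elim (T-not⇒¬T (T-∧⁻ʳ {P e} h) Qye)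
      ... | there Q⟨Ys⟩ = Q⟨Ys⟩
      bounded′ : ∀ {y′} → y′ ∈ˡ Ys → count (λ e → (P e ∧ not (Q y e)) ∧ Q y′ e) xs ≤ b
      bounded′ {y′} y′∈Ys = ℕ.≤-trans (count-mono xs weaken) (bounded (there y′∈Ys))
        where
        weaken : ∀ {e} → T ((P e ∧ not (Q y e)) ∧ Q y′ e) → T (P e ∧ Q y′ e)
        weaken {e} h = T-∧⁺ (T-∧⁻ˡ {P e} (T-∧⁻ˡ {P e ∧ not (Q y e)} h)) (T-∧⁻ʳ {P e ∧ not (Q y e)} h)
      rest = union-bound (λ e → P e ∧ not (Q y e)) Q xs Ys b covered′ bounded′

module Averaging where

  open import Defs using (toℚ)
  open Counting
  open import Data.Bool using (Bool; true; false; T; not)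
  open import Data.List using (List; []; _∷_; length; foldr)
  open import Data.List.Membership.Propositional using () renaming (_∈_ to _∈ˡ_)
  open import Data.List.Relation.Unary.Any using (here; there)
  open import Data.Nat using (ℕ; suc; z≤n) renaming (_≤_ to _≤ℕ_; _+_ to _+ℕ_; _*_ to _*ℕ_)
  import Data.Nat.Properties as ℕ
  open import Data.Integer using (+_)
  import Data.Integer as ℤ
  import Data.Integer.Properties as ℤ
  open import Data.Integer.Solver using () renaming (module +-*-Solver to ℤ-Solver)
  open import Data.Rational using (ℚ; 0ℚ; 1ℚ; _+_; _*_; _-_; -_; _/_; _≤_; _<_; toℚᵘ; NonNegative; nonNegative)
  import Data.Rational.Properties as ℚ
  import Data.Rational.Unnormalised as ℚᵘ
  import Data.Rational.Unnormalised.Properties as ℚᵘ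
  open import Data.Rational.Solver using () renaming (module +-*-Solver to ℚ-Solver)
  open import Data.Nat.Coprimality using (1-coprimeTo) renaming (sym to coprime-sym)
  open import Data.Sum using (inj₁; inj₂)
  open import Function using (_∘′_)
  open import Relation.Binary.PropositionalEquality using (_≡_; refl; sym; trans; cong; cong₂; subst₂)

  private
    toℚᵘ-toℚ : ∀ m → toℚᵘ (toℚ m) ≡ ℚᵘ.mkℚᵘ (+ m) 0
    toℚᵘ-toℚ m rewrite ℚ.normalize-coprime (coprime-sym (1-coprimeTo m)) = refl

    toℚ-via-ℚᵘ : ∀ {m p} → ℚᵘ.mkℚᵘ (+ m) 0 ℚᵘ.≃ toℚᵘ p → toℚ m ≡ p
    toℚ-via-ℚᵘ {m} eq = ℚ.toℚᵘ-injective (ℚᵘ.≃-trans (ℚᵘ.≃-reflexive (toℚᵘ-toℚ m)) eq)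

  toℚ-+ : ∀ a b → toℚ (a +ℕ b) ≡ toℚ a + toℚ b
  toℚ-+ a b = toℚ-via-ℚᵘ (ℚᵘ.≃-sym (ℚᵘ.≃-trans (ℚ.toℚᵘ-homo-+ (toℚ a) (toℚ b))
    (ℚᵘ.≃-reflexive (trans (cong₂ ℚᵘ._+_ (toℚᵘ-toℚ a) (toℚᵘ-toℚ b)) (cong (λ k → ℚᵘ.mkℚᵘ k 0) lemma)))))
    where
    open ℤ-Solver
    lemma : + a ℤ.* + 1 ℤ.+ + b ℤ.* + 1 ≡ + (a +ℕ b)
    lemma = solve 2 (λ x y → x :* con (+ 1) :+ y :* con (+ 1) := x :+ y) refl (+ a) (+ b)

  toℚ-* : ∀ a b → toℚ (a *ℕ b) ≡ toℚ a * toℚ b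
  toℚ-* a b = toℚ-via-ℚᵘ (ℚᵘ.≃-sym (ℚᵘ.≃-trans (ℚ.toℚᵘ-homo-* (toℚ a) (toℚ b))
    (ℚᵘ.≃-reflexive (trans (cong₂ ℚᵘ._*_ (toℚᵘ-toℚ a) (toℚᵘ-toℚ b)) (cong (λ k → ℚᵘ.mkℚᵘ k 0) (sym (ℤ.pos-* a b)))))))

  toℚ-mono-≤ : ∀ {a b} → a ≤ℕ b → toℚ a ≤ toℚ b
  toℚ-mono-≤ {a} {b} a≤b = ℚ.toℚᵘ-cancel-≤ (subst₂ ℚᵘ._≤_ (sym (toℚᵘ-toℚ a)) (sym (toℚᵘ-toℚ b))
    (ℚᵘ.*≤* (subst₂ ℤ._≤_ (sym (ℤ.*-identityʳ (+ a))) (sym (ℤ.*-identityʳ (+ b))) (ℤ.+≤+ a≤b))))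

  toℚ-cancel-≤ : ∀ {a b} → toℚ a ≤ toℚ b → a ≤ℕ b
  toℚ-cancel-≤ {a} {b} le with subst₂ ℚᵘ._≤_ (toℚᵘ-toℚ a) (toℚᵘ-toℚ b) (ℚ.toℚᵘ-mono-≤ le)
  ... | ℚᵘ.*≤* le′ with subst₂ ℤ._≤_ (ℤ.*-identityʳ (+ a)) (ℤ.*-identityʳ (+ b)) le′
  ... | ℤ.+≤+ a≤b = a≤b

  toℚ-nonNeg : ∀ k → 0ℚ ≤ toℚ k
  toℚ-nonNeg k = toℚ-mono-≤ {0} {k} z≤n

  toℚ-pos : ∀ {k} → 1 ≤ℕ k → 0ℚ < toℚ k
  toℚ-pos 1≤k = ℚ.<-≤-trans (ℚ.positive⁻¹ 1ℚ) (toℚ-mono-≤ 1≤k)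

  /-*-cancel : ∀ u l → ((+ u) / suc l) * toℚ (suc l) ≡ toℚ u
  /-*-cancel u l = ℚ.toℚᵘ-injective (ℚᵘ.≃-trans (ℚ.toℚᵘ-homo-* ((+ u) / suc l) (toℚ (suc l)))
    (ℚᵘ.≃-trans (ℚᵘ.*-cong (ℚ.toℚᵘ-fromℚᵘ (ℚᵘ.mkℚᵘ (+ u) l)) (ℚᵘ.≃-reflexive (toℚᵘ-toℚ (suc l))))
    (ℚᵘ.≃-trans (ℚᵘ.*≡* lemma) (ℚᵘ.≃-reflexive (sym (toℚᵘ-toℚ u))))))
    where
    open ℤ-Solver
    lemma : (+ u ℤ.* + suc l) ℤ.* + 1 ≡ + u ℤ.* + (suc l *ℕ 1)
    lemma = trans (solve 2 (λ x y → (x :* y) :* con (+ 1) := x :* y) refl (+ u) (+ suc l))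
                  (cong (λ k → + u ℤ.* + k) (sym (ℕ.*-identityʳ (suc l))))

  p≤q⇒0≤q-p : ∀ {p q} → p ≤ q → 0ℚ ≤ q - p
  p≤q⇒0≤q-p {p} {q} p≤q = ℚ.≤-trans (ℚ.≤-reflexive (sym (ℚ.+-inverseʳ p))) (ℚ.+-monoˡ-≤ (- p) p≤q)

  ≤-via-gap : ∀ {p q} d → 0ℚ ≤ d → p + d ≡ q → p ≤ q
  ≤-via-gap {p} d 0≤d refl = ℚ.≤-trans (ℚ.≤-reflexive (sym (ℚ.+-identityʳ p))) (ℚ.+-monoʳ-≤ p 0≤d)

  *-nonNeg : ∀ {p q} → 0ℚ ≤ p → 0ℚ ≤ q → 0ℚ ≤ p * q
  *-nonNeg {p} 0≤p 0≤q = ℚ.≤-trans (ℚ.≤-reflexive (sym (ℚ.*-zeroʳ p))) (ℚ.*-monoˡ-≤-nonNeg p {{nonNegative 0≤p}} 0≤q)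

  sumℚ : {A : Set} → (A → ℚ) → List A → ℚ
  sumℚ v = foldr (λ e acc → v e + acc) 0ℚ

  mean : {A : Set} → List A → (A → ℚ) → ℚ
  mean []       v = 0ℚ
  mean (a ∷ as) v = ((+ 1) / suc (length as)) * sumℚ v (a ∷ as)

  module _ {A : Set} where

    private
      1/[1+_] : ℕ → ℚ
      1/[1+ l ] = (+ 1) / suc l

      1/[1+]-nonNeg : ∀ l → NonNegative 1/[1+ l ]
      1/[1+]-nonNeg l = ℚ.normalize-nonNeg 1 (suc l)

    sumℚ-cong : {v w : A → ℚ} (xs : List A) → (∀ e → v e ≡ w e) → sumℚ v xs ≡ sumℚ w xs
    sumℚ-cong []       v≡w = refl
    sumℚ-cong (x ∷ xs) v≡w = cong₂ _+_ (v≡w x) (sumℚ-cong xs v≡w)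

    sumℚ-*ˡ : ∀ c (v : A → ℚ) xs → sumℚ (λ e → c * v e) xs ≡ c * sumℚ v xs
    sumℚ-*ˡ c v []       = sym (ℚ.*-zeroʳ c)
    sumℚ-*ˡ c v (x ∷ xs) = trans (cong (λ s → c * v x + s) (sumℚ-*ˡ c v xs)) (sym (ℚ.*-distribˡ-+ c (v x) (sumℚ v xs)))

    sumℚ-mono : {v w : A → ℚ} (xs : List A) → (∀ {e} → e ∈ˡ xs → v e ≤ w e) → sumℚ v xs ≤ sumℚ w xs
    sumℚ-mono []       v≤w = ℚ.≤-refl
    sumℚ-mono (x ∷ xs) v≤w = ℚ.+-mono-≤ (v≤w (here refl)) (sumℚ-mono xs (v≤w ∘′ there))

    sumℚ-≥-count : (p : A → Bool) {v : A → ℚ} {c : ℚ} (xs : List A) → 0ℚ ≤ c →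
      (∀ e → 0ℚ ≤ v e) → (∀ e → T (p e) → c ≤ v e) → toℚ (count p xs) * c ≤ sumℚ v xs
    sumℚ-≥-count p {v} {c} [] 0≤c 0≤v c≤v = ℚ.≤-reflexive (ℚ.*-zeroˡ c)
    sumℚ-≥-count p {v} {c} (x ∷ xs) 0≤c 0≤v c≤v with p x | c≤v x
    ... | true  | c≤vx = ℚ.≤-trans (ℚ.≤-reflexive eq) (ℚ.+-mono-≤ (c≤vx _) (sumℚ-≥-count p xs 0≤c 0≤v c≤v))
      where
      open ℚ-Solver
      k = toℚ (count p xs)
      eq : toℚ (suc (count p xs)) * c ≡ c + k * c
      eq = trans (cong (_* c) (toℚ-+ 1 (count p xs)))
                 (solve 2 (λ k c → (con 1ℚ :+ k) :* c := c :+ k :* c) refl k c)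
    ... | false | _    = ℚ.≤-trans (ℚ.≤-reflexive (sym (ℚ.+-identityˡ _)))
                                   (ℚ.+-mono-≤ (0≤v x) (sumℚ-≥-count p xs 0≤c 0≤v c≤v))

    mean-cong : (xs : List A) {v w : A → ℚ} → (∀ e → v e ≡ w e) → mean xs v ≡ mean xs w
    mean-cong []       v≡w = refl
    mean-cong (x ∷ xs) v≡w = cong (1/[1+ length xs ] *_) (sumℚ-cong (x ∷ xs) v≡w)

    mean-*ˡ : (xs : List A) (c : ℚ) (v : A → ℚ) → mean xs (λ e → c * v e) ≡ c * mean xs v
    mean-*ˡ []       c v = sym (ℚ.*-zeroʳ c)
    mean-*ˡ (x ∷ xs) c v = trans (cong (I *_) (sumℚ-*ˡ c v (x ∷ xs)))
      (solve 3 (λ I c s → I :* (c :* s) := c :* (I :* s)) refl I c (sumℚ v (x ∷ xs)))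
      where
      open ℚ-Solver
      I = 1/[1+ length xs ]

    mean-mono : (xs : List A) {v w : A → ℚ} → (∀ {e} → e ∈ˡ xs → v e ≤ w e) → mean xs v ≤ mean xs w
    mean-mono []       v≤w = ℚ.≤-refl
    mean-mono (x ∷ xs) v≤w = ℚ.*-monoˡ-≤-nonNeg 1/[1+ length xs ] {{1/[1+]-nonNeg (length xs)}} (sumℚ-mono (x ∷ xs) v≤w)

    mean-nonNeg : (xs : List A) {v : A → ℚ} → (∀ e → 0ℚ ≤ v e) → 0ℚ ≤ mean xs v
    mean-nonNeg []       0≤v = ℚ.≤-refl
    mean-nonNeg (x ∷ xs) {v} 0≤v = ℚ.≤-trans (ℚ.≤-reflexive (sym (ℚ.*-zeroʳ I)))
      (ℚ.*-monoˡ-≤-nonNeg I {{1/[1+]-nonNeg (length xs)}} (sumℚ-nonNeg (x ∷ xs)))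
      where
      I = 1/[1+ length xs ]
      sumℚ-nonNeg : ∀ ys → 0ℚ ≤ sumℚ v ys
      sumℚ-nonNeg []       = ℚ.≤-refl
      sumℚ-nonNeg (y ∷ ys) = ℚ.+-mono-≤ (0≤v y) (sumℚ-nonNeg ys)

    mean-≥ : (stay : A → Bool) (xs : List A) {v : A → ℚ} {c p : ℚ} →
      1 ≤ℕ length xs → 0ℚ ≤ p → c ≤ 1ℚ → (∀ e → 0ℚ ≤ v e) → (∀ e → T (stay e) → c ≤ v e) →
      toℚ (count (not ∘′ stay) xs) ≤ p * toℚ (length xs) →
      c - p ≤ mean xs v
    mean-≥ stay xs {v} {c} {p} 1≤len 0≤p c≤1 0≤v c≤v leave≤ with ℚ.≤-total c 0ℚ
    ... | inj₁ c≤0 = ℚ.≤-trans (≤-via-gap p 0≤p (solve 2 (λ c p → (c :- p) :+ p := c) refl c p))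
                               (ℚ.≤-trans c≤0 (mean-nonNeg xs 0≤v))
      where open ℚ-Solver
    mean-≥ stay (x ∷ xs) {v} {c} {p} 1≤len 0≤p c≤1 0≤v c≤v leave≤ | inj₂ 0≤c = begin
      c - p                     ≤⟨ ≤-via-gap (p * (1ℚ - c)) (*-nonNeg 0≤p (p≤q⇒0≤q-p c≤1))
                                     (solve 2 (λ c p → (c :- p) :+ p :* (con 1ℚ :- c) := (con 1ℚ :- p) :* c) refl c p) ⟩
      (1ℚ - p) * c              ≡⟨ sym (trans (cong ((1ℚ - p) * c *_) (/-*-cancel 1 (length xs))) (ℚ.*-identityʳ _)) ⟩
      (1ℚ - p) * c * (I * L)    ≡⟨ solve 4 (λ I L p c → (con 1ℚ :- p) :* c :* (I :* L) := I :* ((L :- p :* L) :* c)) refl I L p c ⟩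
      I * ((L - p * L) * c)     ≤⟨ ℚ.*-monoˡ-≤-nonNeg I {{1/[1+]-nonNeg (length xs)}}
                                     (ℚ.*-monoʳ-≤-nonNeg c {{nonNegative 0≤c}} L-pL≤S) ⟩
      I * (S * c)               ≤⟨ ℚ.*-monoˡ-≤-nonNeg I {{1/[1+]-nonNeg (length xs)}}
                                     (sumℚ-≥-count stay (x ∷ xs) 0≤c 0≤v c≤v) ⟩
      mean (x ∷ xs) v           ∎
      where
      open ℚ.≤-Reasoning
      open ℚ-Solver
      I = 1/[1+ length xs ]
      L = toℚ (suc (length xs))
      S = toℚ (count stay (x ∷ xs))
      B = toℚ (count (not ∘′ stay) (x ∷ xs))
      L≡S+B : L ≡ S + B
      L≡S+B = trans (cong toℚ (length≡count+count-not stay (x ∷ xs))) (toℚ-+ (count stay (x ∷ xs)) _)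
      L-pL≤S : L - p * L ≤ S
      L-pL≤S = ≤-via-gap (p * L - B) (p≤q⇒0≤q-p leave≤)
        (trans (cong (λ l → l - p * l + (p * l - B)) L≡S+B)
               (solve 3 (λ S B p → (S :+ B) :- p :* (S :+ B) :+ (p :* (S :+ B) :- B) := S) refl S B p))

module Process where

  open import Defs
  open Counting
  open Averaging
  open import Data.Bool using (Bool; true; false; T; T?; not; _∧_; if_then_else_)
  open import Data.Bool.ListAction using (all; any)
  open import Data.Fin.Subset using (Subset; ∣_∣)
  open import Data.List using (List; []; _∷_; _++_; [_]; length)
  import Data.List.Properties as List
  open import Data.List.Membership.Propositional using () renaming (_∈_ to _∈ˡ_)
  open import Data.List.Membership.Propositional.Properties using (∈-filter⁻)
  open import Data.List.Relation.Unary.All using (All; []; _∷_) renaming (map to All-map)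
  import Data.List.Relation.Unary.All.Properties as All
  import Data.List.Relation.Unary.AllPairs as AllPairs
  import Data.List.Relation.Unary.AllPairs.Properties as AllPairs
  open import Data.List.Relation.Unary.Unique.Propositional using (Unique)
  open import Data.Nat using (ℕ; zero; suc; _+_; _≟_)
  import Data.Nat.Properties as ℕ
  open import Data.Product using (_×_; _,_; proj₁; proj₂)
  open import Data.Rational using (ℚ; 0ℚ; 1ℚ; _*_; _≤_)
  import Data.Rational.Properties as ℚ
  open import Function using (_∘_)
  open import Relation.Binary.PropositionalEquality using (_≡_; _≢_; refl; sym; trans; cong; subst)
  open import Relation.Nullary.Decidable using (fromWitness)

  𝟙 : Bool → ℚ
  𝟙 b = if b then 1ℚ else 0ℚ

  𝟙-nonNeg : ∀ b → 0ℚ ≤ 𝟙 b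
  𝟙-nonNeg true  = ℚ.nonNegative⁻¹ 1ℚ
  𝟙-nonNeg false = ℚ.≤-refl

  module _ {n : ℕ} where

    ∈-admissible⁻ : ∀ {r F e} → e ∈ˡ admissible n r F → ∣ e ∣ ≡ r × T (not (any (e ==_) F))
    ∈-admissible⁻ {r} {F} e∈A with ∈-filter⁻ (λ e → T? (not (any (e ==_) F) ∧ all (meets e) F)) {xs = rSets n r} e∈A
    ... | e∈rSets , admissible-e = proj₂ (∈-filter⁻ (λ s → ∣ s ∣ ≟ r) {xs = allSubsets n} e∈rSets) , T-∧⁻ˡ admissible-e

    not-any-==⇒All-≢ : ∀ {e} (F : List (Subset n)) → T (not (any (e ==_) F)) → All (_≢ e) F
    not-any-==⇒All-≢ []      _   = []
    not-any-==⇒All-≢ {e} (f ∷ F) e∉F with e == f in e==f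
    ... | false = (λ f≡e → subst T e==f (fromWitness (sym f≡e))) ∷ not-any-==⇒All-≢ F e∉F

  module _ (n r : ℕ) where

    -- The expectation of g after k further steps from the history F; a halted
    -- process contributes 0, exactly as in runProb.
    runExp : ℕ → List (Subset n) → (List (Subset n) → ℚ) → ℚ
    runExp zero    F g = g F
    runExp (suc k) F g = mean (admissible n r F) (λ e → runExp k (F ++ [ e ]) g)

    runProb≡runExp-𝟙 : ∀ k F P → runProb n r k F P ≡ runExp k F (𝟙 ∘ P)
    runProb≡runExp-𝟙 zero    F P = refl
    runProb≡runExp-𝟙 (suc k) F P = trans (unfold-step F) (mean-cong (admissible n r F) (λ e → runProb≡runExp-𝟙 k (F ++ [ e ]) P))
      where
      unfold-step : ∀ F → runProb n r (suc k) F P ≡ mean (admissible n r F) (λ e → runProb n r k (F ++ [ e ]) P)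
      unfold-step F with admissible n r F
      ... | []    = refl
      ... | _ ∷ _ = refl

    runExp-+ : ∀ a b F g → runExp (a + b) F g ≡ runExp a F (λ F′ → runExp b F′ g)
    runExp-+ zero    b F g = refl
    runExp-+ (suc a) b F g = mean-cong (admissible n r F) (λ e → runExp-+ a b (F ++ [ e ]) g)

    runExp-*ˡ : ∀ k F c g → runExp k F (λ F′ → c * g F′) ≡ c * runExp k F g
    runExp-*ˡ zero    F c g = refl
    runExp-*ˡ (suc k) F c g = trans (mean-cong (admissible n r F) (λ e → runExp-*ˡ k (F ++ [ e ]) c g))
                                    (mean-*ˡ (admissible n r F) c _)

    runExp-nonNeg : ∀ k F {g} → (∀ F′ → 0ℚ ≤ g F′) → 0ℚ ≤ runExp k F g
    runExp-nonNeg zero    F 0≤g = 0≤g F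
    runExp-nonNeg (suc k) F 0≤g = mean-nonNeg (admissible n r F) (λ e → runExp-nonNeg k (F ++ [ e ]) 0≤g)

    data Reachable : List (Subset n) → Set where
      initial : Reachable []
      step  : ∀ {F e} → Reachable F → e ∈ˡ admissible n r F → Reachable (F ++ [ e ])

    runExp-mono : ∀ k {F g h} → Reachable F →
      (∀ {F′} → Reachable F′ → length F′ ≡ length F + k → g F′ ≤ h F′) → runExp k F g ≤ runExp k F h
    runExp-mono zero    {F} reach g≤h = g≤h reach (sym (ℕ.+-identityʳ (length F)))
    runExp-mono (suc k) {F} reach g≤h = mean-mono (admissible n r F) λ {e} e∈A →
      runExp-mono k (step reach e∈A) λ reach′ len≡ → g≤h reach′ (trans len≡ (length-snoc e))
      where
      length-snoc : ∀ e → length (F ++ [ e ]) + k ≡ length F + suc k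
      length-snoc e = trans (cong (_+ k) (List.length-++ F)) (ℕ.+-assoc (length F) 1 k)

    Reachable⇒sizes : ∀ {F} → Reachable F → All (λ e → ∣ e ∣ ≡ r) F
    Reachable⇒sizes initial            = []
    Reachable⇒sizes (step {F} reach e∈A) = All.++⁺ (Reachable⇒sizes reach) (proj₁ (∈-admissible⁻ {F = F} e∈A) ∷ [])

    Reachable⇒Unique : ∀ {F} → Reachable F → Unique F
    Reachable⇒Unique initial                = AllPairs.[]
    Reachable⇒Unique (step {F} reach e∈A) = AllPairs.++⁺ (Reachable⇒Unique reach) ([] AllPairs.∷ AllPairs.[])
      (All-map (_∷ []) (not-any-==⇒All-≢ F (proj₂ (∈-admissible⁻ {F = F} e∈A))))

module Survival where

  open import Defs
  open Counting
  open Averaging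
  open Process
  open import Data.Bool using (Bool; T; not)
  open import Data.Fin.Subset using (Subset)
  open import Data.List using (List; _++_; [_]; length)
  import Data.List.Properties as List
  open import Data.Nat using (ℕ; zero; suc; _+_; s≤s; z≤n) renaming (_≤_ to _≤ℕ_; _<_ to _<ℕ_)
  import Data.Nat.Properties as ℕ
  open import Data.Product using (_×_; proj₁; proj₂)
  open import Data.Rational using (ℚ; 0ℚ; 1ℚ; _*_; _-_; _≤_)
  import Data.Rational.Properties as ℚ
  open import Data.Rational.Solver using () renaming (module +-*-Solver to ℚ-Solver)
  open import Function using (_∘′_)
  open import Relation.Binary.PropositionalEquality using (_≡_; refl; sym; trans; cong; subst)

  module _ (n r : ℕ) (stay : Subset n → Bool) (Good : List (Subset n) → Set)
    (Good-step : ∀ {F e} → Good F → T (stay e) → Good (F ++ [ e ]))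
    (ℓ : ℕ) (p : ℚ) (0≤p : 0ℚ ≤ p)
    (hazard : ∀ {F} → Good F → length F <ℕ ℓ →
       1 ≤ℕ length (admissible n r F) ×
       toℚ (count (not ∘′ stay) (admissible n r F)) ≤ p * toℚ (length (admissible n r F)))
    where

    open ℚ-Solver

    survival : ∀ j F {g} → Good F → length F + j ≤ℕ ℓ →
      (∀ {F′} → Good F′ → 1ℚ ≤ g F′) → (∀ F′ → 0ℚ ≤ g F′) → 1ℚ - toℚ j * p ≤ runExp n r j F g
    survival zero F good _ 1≤g _ =
      ℚ.≤-trans (ℚ.≤-reflexive (solve 1 (λ p → con 1ℚ :- con 0ℚ :* p := con 1ℚ) refl p)) (1≤g good)
    survival (suc j) F {g} good len≤ℓ 1≤g 0≤g = subst (_≤ runExp n r (suc j) F g) (sym 1-[1+j]p≡c-p)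
      (mean-≥ stay (admissible n r F) (proj₁ step-hazard) 0≤p c≤1 (λ e → runExp-nonNeg n r j (F ++ [ e ]) 0≤g)
        (λ e stay-e → survival j (F ++ [ e ]) (Good-step good stay-e) (len′≤ℓ e) 1≤g 0≤g) (proj₂ step-hazard))
      where
      step-hazard = hazard good (ℕ.<-≤-trans (ℕ.m<m+n (length F) (s≤s z≤n)) len≤ℓ)
      c = 1ℚ - toℚ j * p
      1-[1+j]p≡c-p : 1ℚ - toℚ (suc j) * p ≡ c - p
      1-[1+j]p≡c-p = trans (cong (λ t → 1ℚ - t * p) (toℚ-+ 1 j))
        (solve 2 (λ t p → con 1ℚ :- (con 1ℚ :+ t) :* p := (con 1ℚ :- t :* p) :- p) refl (toℚ j) p)
      c≤1 : c ≤ 1ℚ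
      c≤1 = ≤-via-gap (toℚ j * p) (*-nonNeg (toℚ-nonNeg j) 0≤p)
        (solve 2 (λ t p → (con 1ℚ :- t :* p) :+ t :* p := con 1ℚ) refl (toℚ j) p)
      len′≤ℓ : ∀ e → length (F ++ [ e ]) + j ≤ℕ ℓ
      len′≤ℓ e = subst (_≤ℕ ℓ) (sym (trans (cong (_+ j) (List.length-++ F)) (ℕ.+-assoc (length F) 1 j))) len≤ℓ

module Supersets where

  open import Defs
  open Counting
  open import Data.Bool using (Bool; true; false; T; not; _∧_; _∨_; if_then_else_)
  open import Data.Bool.Properties using (∧-zeroʳ; T-∨)
  open import Data.Empty using (⊥; ⊥-elim)
  open import Data.Fin using (Fin; zero; suc) renaming (_≟_ to _≟ᶠ_)
  open import Data.Fin.Subset using (Subset; ∣_∣; inside; outside)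
  open import Data.List using (List; []; _∷_; map; length; tabulate)
  open import Data.List.Relation.Unary.All.Properties using (All¬⇒¬Any)
  open import Data.List.Relation.Unary.AllPairs using (_∷_)
  open import Data.List.Relation.Unary.Unique.Propositional using (Unique)
  open import Data.Nat using (ℕ; zero; suc; _+_; _∸_; _≤_; _<_; _≟_; s≤s)
  open import Data.Nat.Combinatorics using (_C_; nCk+nC[k+1]≡[n+1]C[k+1])
  import Data.Nat.Properties as ℕ
  open import Data.Sum using (inj₁; inj₂)
  open import Data.Vec using ([]; _∷_; lookup)
  open import Function using (_∘_)
  open import Function.Bundles using (Equivalence)
  open import Relation.Binary.PropositionalEquality using (_≡_; refl; sym; trans; cong; cong₂; subst)
  open import Relation.Nullary using (does; yes)

  countFin : ∀ {n} → (Fin n → Bool) → ℕ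
  countFin {zero}  p = 0
  countFin {suc n} p = (if p zero then 1 else 0) + countFin (p ∘ suc)

  -- D is the indicator of a point set. The head test is b ∨ not (D zero) rather
  -- than an implication so that it computes whenever b is a constructor.
  containsAll : ∀ {n} → (Fin n → Bool) → Subset n → Bool
  containsAll D []      = true
  containsAll D (b ∷ e) = (b ∨ not (D zero)) ∧ containsAll (D ∘ suc) e

  hasSize : ∀ {n} → ℕ → Subset n → Bool
  hasSize r e = does (∣ e ∣ ≟ r)

  #supersets : ∀ {n} → (Fin n → Bool) → ℕ → ℕ
  #supersets {n} D r = count (λ e → hasSize r e ∧ containsAll D e) (allSubsets n)

  count-allSubsets-suc : ∀ {n} (p : Subset (suc n) → Bool) →
    count p (allSubsets (suc n)) ≡ count (p ∘ (outside ∷_)) (allSubsets n) + count (p ∘ (inside ∷_)) (allSubsets n)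
  count-allSubsets-suc {n} p = trans (count-++ p (map (outside ∷_) (allSubsets n)) (map (inside ∷_) (allSubsets n)))
    (cong₂ _+_ (count-map p (outside ∷_) (allSubsets n)) (count-map p (inside ∷_) (allSubsets n)))

  module _ {n : ℕ} (D : Fin (suc n) → Bool) where

    private
      tail = D ∘ suc
      split : ∀ r → #supersets D r ≡ count (λ e → hasSize r e ∧ (not (D zero) ∧ containsAll tail e)) (allSubsets n)
                                     + count (λ e → hasSize r (inside ∷ e) ∧ containsAll tail e) (allSubsets n)
      split r = count-allSubsets-suc (λ e → hasSize r e ∧ containsAll D e)
      none : ∀ {q : Subset n → Bool} → (∀ e → q e ≡ false) → count q (allSubsets n) ≡ 0
      none = count-false (allSubsets n)

    #supersets-in-zero : D zero ≡ true → #supersets D 0 ≡ 0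
    #supersets-in-zero D0 rewrite split 0 | D0 = cong₂ _+_ (none (λ e → ∧-zeroʳ _)) (none (λ e → refl))

    #supersets-in-suc : D zero ≡ true → ∀ r → #supersets D (suc r) ≡ #supersets tail r
    #supersets-in-suc D0 r rewrite split (suc r) | D0 = cong (_+ #supersets tail r) (none (λ e → ∧-zeroʳ _))

    #supersets-out-zero : D zero ≡ false → #supersets D 0 ≡ #supersets tail 0
    #supersets-out-zero D0 rewrite split 0 | D0 = trans (cong (#supersets tail 0 +_) (none (λ e → refl))) (ℕ.+-identityʳ _)

    #supersets-out-suc : D zero ≡ false → ∀ r → #supersets D (suc r) ≡ #supersets tail (suc r) + #supersets tail r
    #supersets-out-suc D0 r rewrite split (suc r) | D0 = refl

  #supersets-< : ∀ {n} (D : Fin n → Bool) r → r < countFin D → #supersets D r ≡ 0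
  #supersets-< {suc n} D r r<∣D∣ with D zero in D0
  #supersets-< {suc n} D zero    r<∣D∣       | true  = #supersets-in-zero D D0
  #supersets-< {suc n} D (suc r) (s≤s r<∣D∣) | true  =
    trans (#supersets-in-suc D D0 r) (#supersets-< (D ∘ suc) r r<∣D∣)
  #supersets-< {suc n} D zero    r<∣D∣       | false =
    trans (#supersets-out-zero D D0) (#supersets-< (D ∘ suc) zero r<∣D∣)
  #supersets-< {suc n} D (suc r) r<∣D∣       | false =
    trans (#supersets-out-suc D D0 r)
          (cong₂ _+_ (#supersets-< (D ∘ suc) (suc r) r<∣D∣) (#supersets-< (D ∘ suc) r (ℕ.<-trans (ℕ.n<1+n r) r<∣D∣)))

  #supersets-≥ : ∀ {n} (D : Fin n → Bool) r → countFin D ≤ r →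
    #supersets D r ≡ countFin (not ∘ D) C (r ∸ countFin D)
  #supersets-≥ {zero}  D zero    _ = refl
  #supersets-≥ {zero}  D (suc r) _ = refl
  #supersets-≥ {suc n} D r ∣D∣≤r with D zero in D0
  #supersets-≥ {suc n} D (suc r) (s≤s ∣D∣≤r) | true =
    trans (#supersets-in-suc D D0 r) (#supersets-≥ (D ∘ suc) r ∣D∣≤r)
  #supersets-≥ {suc n} D zero    ∣D∣≤r       | false
    rewrite #supersets-out-zero D D0 | #supersets-≥ (D ∘ suc) zero ∣D∣≤r | ℕ.0∸n≡0 (countFin (D ∘ suc)) = refl
  #supersets-≥ {suc n} D (suc r) ∣D∣≤r       | false with ℕ.m≤n⇒m<n∨m≡n ∣D∣≤r
  ... | inj₁ (s≤s ∣D∣≤r′) rewrite #supersets-out-suc D D0 r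
                                | #supersets-≥ (D ∘ suc) (suc r) ∣D∣≤r | #supersets-≥ (D ∘ suc) r ∣D∣≤r′
                                | ℕ.+-∸-assoc 1 ∣D∣≤r′ =
    trans (ℕ.+-comm (m C suc k) (m C k)) (nCk+nC[k+1]≡[n+1]C[k+1] m k)
    where
    m = countFin (not ∘ D ∘ suc)
    k = r ∸ countFin (D ∘ suc)
  ... | inj₂ ∣D∣≡1+r rewrite #supersets-out-suc D D0 r
                           | #supersets-< (D ∘ suc) r (subst (r <_) (sym ∣D∣≡1+r) (ℕ.n<1+n r))
                           | #supersets-≥ (D ∘ suc) (suc r) ∣D∣≤r | ∣D∣≡1+r | ℕ.n∸n≡0 r = refl

  countFin-cong : ∀ {n} {p q : Fin n → Bool} → (∀ i → p i ≡ q i) → countFin p ≡ countFin q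
  countFin-cong {zero}  p≡q = refl
  countFin-cong {suc n} p≡q = cong₂ _+_ (cong (λ b → if b then 1 else 0) (p≡q zero)) (countFin-cong (p≡q ∘ suc))

  countFin-false : ∀ {n} → countFin {n} (λ _ → false) ≡ 0
  countFin-false {zero}  = refl
  countFin-false {suc n} = countFin-false {n}

  countFin+countFin-not : ∀ {n} (p : Fin n → Bool) → countFin p + countFin (not ∘ p) ≡ n
  countFin+countFin-not {zero}  p = refl
  countFin+countFin-not {suc n} p with p zero
  ... | true  = cong suc (countFin+countFin-not (p ∘ suc))
  ... | false = trans (ℕ.+-suc _ _) (cong suc (countFin+countFin-not (p ∘ suc)))

  countFin-≟ : ∀ {n} (d : Fin n) → countFin (λ i → does (i ≟ᶠ d)) ≡ 1
  countFin-≟ {suc n} zero    = cong suc (countFin-false {n})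
  countFin-≟ {suc n} (suc d) = countFin-≟ d

  countFin-∨ : ∀ {n} (p q : Fin n → Bool) → (∀ i → T (p i) → T (q i) → ⊥) →
    countFin (λ i → p i ∨ q i) ≡ countFin p + countFin q
  countFin-∨ {zero}  p q disjoint = refl
  countFin-∨ {suc n} p q disjoint with p zero | q zero | disjoint zero
  ... | true  | true  | pq⇒⊥ = ⊥-elim (pq⇒⊥ _ _)
  ... | true  | false | _ = cong suc (countFin-∨ (p ∘ suc) (q ∘ suc) (disjoint ∘ suc))
  ... | false | true  | _ = trans (cong suc (countFin-∨ (p ∘ suc) (q ∘ suc) (disjoint ∘ suc))) (sym (ℕ.+-suc _ _))
  ... | false | false | _ = countFin-∨ (p ∘ suc) (q ∘ suc) (disjoint ∘ suc)

  containsAll⁺ : ∀ {n} (D : Fin n → Bool) (e : Subset n) → (∀ i → T (D i) → T (lookup e i)) → T (containsAll D e)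
  containsAll⁺ D []      _   = _
  containsAll⁺ D (b ∷ e) D⊆e = T-∧⁺ head (containsAll⁺ (D ∘ suc) e (D⊆e ∘ suc))
    where
    head : T (b ∨ not (D zero))
    head with D zero | D⊆e zero
    ... | true  | b∈e = Equivalence.from (T-∨ {b}) (inj₁ (b∈e _))
    ... | false | _   = Equivalence.from (T-∨ {b}) (inj₂ _)

  containsAll⁻ : ∀ {n} (D : Fin n → Bool) (e : Subset n) → T (containsAll D e) → ∀ i → T (D i) → T (lookup e i)
  containsAll⁻ D (b ∷ e) D⊆e zero D0 with Equivalence.to (T-∨ {b}) (T-∧⁻ˡ {b ∨ not (D zero)} D⊆e)
  ... | inj₁ b-holds = b-holds
  ... | inj₂ ¬D0 with D zero
  ...   | true  = ⊥-elim ¬D0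
  ...   | false = ⊥-elim D0
  containsAll⁻ D (b ∷ e) D⊆e (suc i) Di = containsAll⁻ (D ∘ suc) e (T-∧⁻ʳ {b ∨ not (D zero)} D⊆e) i Di

  module _ {n : ℕ} where

    open import Data.List.Membership.DecPropositional (_≟ᶠ_ {n}) using (_∈?_)

    countFin-∈ : ∀ {ds : List (Fin n)} → Unique ds → countFin (λ i → does (i ∈? ds)) ≡ length ds
    countFin-∈ {[]}     _ = countFin-false {n}
    countFin-∈ {d ∷ ds} (d∉ds ∷ unique) =
      trans (countFin-∨ (λ i → does (i ≟ᶠ d)) (λ i → does (i ∈? ds)) disjoint)
            (cong₂ _+_ (countFin-≟ d) (countFin-∈ unique))
      where
      disjoint : ∀ i → T (does (i ≟ᶠ d)) → T (does (i ∈? ds)) → ⊥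
      disjoint i i≡d i∈ds with i ≟ᶠ d | i ∈? ds
      ... | yes refl | yes d∈ds = All¬⇒¬Any d∉ds d∈ds


  count-tabulate : ∀ {A : Set} {n} (p : A → Bool) (f : Fin n → A) → count p (tabulate f) ≡ countFin (p ∘ f)
  count-tabulate {n = zero}  p f = refl
  count-tabulate {n = suc n} p f with p (f zero)
  ... | true  = cong suc (count-tabulate p (f ∘ suc))
  ... | false = count-tabulate p (f ∘ suc)

  countFin-lookup : ∀ {n} (S : Subset n) → countFin (lookup S) ≡ ∣ S ∣
  countFin-lookup []           = refl
  countFin-lookup (inside ∷ S)  = cong suc (countFin-lookup S)
  countFin-lookup (outside ∷ S) = countFin-lookup S

  countFin-not : ∀ {n} (p : Fin n → Bool) → countFin (not ∘ p) ≡ n ∸ countFin p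
  countFin-not {n} p = sym (trans (cong (_∸ countFin p) (sym (countFin+countFin-not p))) (ℕ.m+n∸m≡n (countFin p) _))

module Admissible where

  open import Defs
  open Counting
  open Supersets
  open import Data.Bool using (Bool; false; T; not; _∧_)
  open import Data.Bool.Properties using (T-≡) renaming (_≟_ to _≟ᵇ_)
  open import Data.Bool.ListAction using (all; any)
  open import Data.Fin using (Fin; zero; suc)
  open import Data.Fin.Subset using (Subset; ∣_∣; inside; outside; _∩_; ⁅_⁆; _∈_; _∉_; _-_; ⋂)
  open import Data.Fin.Subset.Properties using (nonempty?; x∈p∩q⁺; x∈p∩q⁻; ∈⊤; Empty-unique; x∈p⇒∣p-x∣<∣p∣)
  open import Data.List using (List; []; _∷_; length; take)
  open import Data.List.Membership.Propositional using () renaming (_∈_ to _∈ˡ_)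
  open import Data.List.Relation.Unary.All using (All; []; _∷_)
  open import Data.List.Relation.Unary.AllPairs using (_∷_)
  open import Data.List.Relation.Unary.Any using (Any)
  import Data.List.Relation.Unary.Any.Properties as Any
  open import Data.Nat using (ℕ; zero; suc; _+_; _*_; _≤_; _<_; _≟_)
  import Data.Nat.Properties as ℕ
  open import Data.Product using (∃; _×_; _,_)
  open import Data.Unit using (tt)
  open import Data.Vec using ([]; _∷_; lookup; here; there)
  open import Data.Vec.Properties using ([]=⇒lookup; lookup⇒[]=; ≡-dec)
  open import Data.Empty using (⊥-elim)
  open import Function.Bundles using (Equivalence)
  open import Relation.Nullary using (does)
  open import Relation.Nullary.Decidable using (toWitness; fromWitness; isYes≗does)
  open import Relation.Binary.PropositionalEquality using (_≡_; refl; sym; trans; cong; cong₂; subst)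

  ==-∷ : ∀ {n} (b c : Bool) (e f : Subset n) → (b ∷ e) == (c ∷ f) ≡ does (b ≟ᵇ c) ∧ (e == f)
  ==-∷ b c e f = trans (isYes≗does (≡-dec _≟ᵇ_ (b ∷ e) (c ∷ f)))
                       (cong (does (b ≟ᵇ c) ∧_) (sym (isYes≗does (≡-dec _≟ᵇ_ e f))))

  count-== : ∀ {n} (f : Subset n) → count (_== f) (allSubsets n) ≡ 1
  count-== []      = refl
  count-== {suc n} (c ∷ f) = trans (count-allSubsets-suc (_== (c ∷ f)))
    (trans (cong₂ _+_ (count-cong (allSubsets n) (λ e → ==-∷ outside c e f)) (count-cong (allSubsets n) (λ e → ==-∷ inside c e f)))
           (by-head c))
    where
    none : count (λ _ → false) (allSubsets n) ≡ 0
    none = count-false (allSubsets n) (λ _ → refl)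
    by-head : ∀ c → count (λ e → does (outside ≟ᵇ c) ∧ (e == f)) (allSubsets n)
                  + count (λ e → does (inside ≟ᵇ c) ∧ (e == f)) (allSubsets n) ≡ 1
    by-head outside = trans (cong₂ _+_ (count-== f) none) refl
    by-head inside  = cong₂ _+_ none (count-== f)

  size-0⇒∉ : ∀ {n} {S : Subset n} {x} → ∣ S ∣ ≡ 0 → x ∉ S
  size-0⇒∉ {S = S} {x} ∣S∣≡0 x∈S = ℕ.n≮0 (subst (∣ S - x ∣ <_) ∣S∣≡0 (x∈p⇒∣p-x∣<∣p∣ x∈S))

  size-1⇒singleton : ∀ {n} {S : Subset n} {x} → ∣ S ∣ ≡ 1 → x ∈ S → S ≡ ⁅ x ⁆
  size-1⇒singleton {S = inside ∷ S}  {zero}  ∣S∣≡1 here        =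
    cong (inside ∷_) (Empty-unique (λ (y , y∈S) → size-0⇒∉ (ℕ.suc-injective ∣S∣≡1) y∈S))
  size-1⇒singleton {S = outside ∷ S} {suc x} ∣S∣≡1 (there x∈S) = cong (outside ∷_) (size-1⇒singleton ∣S∣≡1 x∈S)
  size-1⇒singleton {S = inside ∷ S}  {suc x} ∣S∣≡1 (there x∈S) = ⊥-elim (size-0⇒∉ (ℕ.suc-injective ∣S∣≡1) x∈S)

  kernel∈⋂ : ∀ {n} {x : Fin n} k (F : List (Subset n)) → All (x ∈_) F → x ∈ ⋂ (take k F)
  kernel∈⋂ zero    F       _          = ∈⊤
  kernel∈⋂ (suc k) []      _          = ∈⊤
  kernel∈⋂ (suc k) (S ∷ F) (x∈S ∷ x∈F) = x∈p∩q⁺ (x∈S , kernel∈⋂ k F x∈F)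

  module _ {n : ℕ} where

    fresh : List (Subset n) → Subset n → Bool
    fresh F e = not (any (e ==_) F)

    count-admissible : ∀ r F (q : Subset n → Bool) → count q (admissible n r F)
      ≡ count (λ e → hasSize r e ∧ ((fresh F e ∧ all (meets e) F) ∧ q e)) (allSubsets n)
    count-admissible r F q = trans (count-filter _ q (rSets n r)) (count-filter (λ s → ∣ s ∣ ≟ r) _ (allSubsets n))

    count-fresh : ∀ (p : Subset n → Bool) F → count p (allSubsets n) ≤ count (λ e → p e ∧ fresh F e) (allSubsets n) + length F
    count-fresh p F = begin
      count p (allSubsets n)                                   ≡⟨ count-∧-split p (λ e → any (e ==_) F) (allSubsets n) ⟩
      count (λ e → p e ∧ any (e ==_) F) (allSubsets n) + kept
        ≤⟨ ℕ.+-monoˡ-≤ kept (union-bound _ (λ f e → e == f) (allSubsets n) F 1 covered bounded) ⟩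
      length F * 1 + kept                                      ≡⟨ cong (_+ kept) (ℕ.*-identityʳ (length F)) ⟩
      length F + kept                                          ≡⟨ ℕ.+-comm (length F) kept ⟩
      kept + length F                                          ∎
      where
      open ℕ.≤-Reasoning
      kept = count (λ e → p e ∧ fresh F e) (allSubsets n)
      covered : ∀ {e} → T (p e ∧ any (e ==_) F) → Any (λ f → T (e == f)) F
      covered {e} h = Any.any⁻ (e ==_) F (T-∧⁻ʳ {p e} h)
      bounded : ∀ {f} → f ∈ˡ F → count (λ e → (p e ∧ any (e ==_) F) ∧ (e == f)) (allSubsets n) ≤ 1
      bounded {f} _ = ℕ.≤-trans (count-mono (allSubsets n) (λ {e} h → T-∧⁻ʳ {p e ∧ any (e ==_) F} h))
                                (ℕ.≤-reflexive (count-== f))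

    ∈⇒T-lookup : ∀ {x : Fin n} {p} → x ∈ p → T (lookup p x)
    ∈⇒T-lookup x∈p = subst T (sym ([]=⇒lookup x∈p)) tt

    T-lookup⇒∈ : ∀ {x : Fin n} {p} → T (lookup p x) → x ∈ p
    T-lookup⇒∈ {x} {p} px = lookup⇒[]= x p (Equivalence.to T-≡ px)

    meets⁺ : ∀ {e s : Subset n} {y} → y ∈ e → y ∈ s → T (meets e s)
    meets⁺ y∈e y∈s = fromWitness (_ , x∈p∩q⁺ (y∈e , y∈s))

    meets⁻ : ∀ {e s : Subset n} → T (meets e s) → ∃ λ y → y ∈ e × y ∈ s
    meets⁻ {e} {s} h with toWitness {a? = nonempty? (e ∩ s)} h
    ... | y , y∈e∩s = y , x∈p∩q⁻ e s y∈e∩s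

module Stars where

  open import Defs
  open Counting
  open Supersets
  open Admissible
  open import Data.Bool using (Bool; true; T; T?; not; _∧_)
  open import Data.Bool.ListAction using (all)
  open import Data.Fin using (Fin) renaming (_≟_ to _≟ᶠ_)
  open import Data.Fin.Subset using (Subset; ∣_∣; _∩_; ⁅_⁆; _∈_; _∉_)
  open import Data.Fin.Subset.Properties using (x∈p∩q⁺; x∈p∩q⁻; x∈⁅x⁆; x∈⁅y⁆⇒x≡y)
  open import Data.List using (List; []; _∷_; length; allFin; filter)
  open import Data.List.Membership.Propositional using (lose) renaming (_∈_ to _∈ˡ_)
  open import Data.List.Membership.Propositional.Properties using (∈-filter⁺; ∈-filter⁻; ∈-allFin)
  open import Data.List.Relation.Unary.All using (All; []; _∷_) renaming (map to All-map; lookup to All-lookup; head to All-head; tail to All-tail)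
  import Data.List.Relation.Unary.All.Properties as All
  open import Data.List.Relation.Unary.AllPairs using (AllPairs; []; _∷_) renaming (map to AllPairs-map)
  open import Data.List.Relation.Unary.Unique.Propositional using (Unique)
  open import Data.List.Relation.Unary.Any using (Any; satisfied)
  import Data.List.Relation.Unary.Any.Properties as Any
  open import Data.Nat using (ℕ; _+_; _*_; _^_; _≤_)
  import Data.Nat.Properties as ℕ
  open import Data.Product using (∃; _×_; _,_; proj₁; proj₂)
  open import Data.Unit using (tt)
  open import Data.Vec using ([]; _∷_; lookup)
  open import Function using (_∘_)
  open import Relation.Nullary using (does; yes)
  open import Relation.Nullary.Decidable using (toWitness; dec-true; dec-false)
  open import Relation.Binary.PropositionalEquality using (_≡_; _≢_; refl; sym; trans; cong; subst)

  module _ {n : ℕ} where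

    Star : Fin n → List (Subset n) → Set
    Star x = AllPairs (λ s t → s ∩ t ≡ ⁅ x ⁆)

    isStar⇒Star : ∀ F → T (isStar F) → ∃ λ x → Star x F
    isStar⇒Star F h with satisfied (Any.any⁻ _ (allFin n) h)
    ... | x , pairs = x , AllPairs-map toWitness (pairsOK⇒AllPairs F pairs)
      where
      pairsOK⇒AllPairs : ∀ {R : Subset n → Subset n → Bool} F → T (pairsOK R F) → AllPairs (λ s t → T (R s t)) F
      pairsOK⇒AllPairs []       _ = []
      pairsOK⇒AllPairs {R} (s ∷ ss) h =
        All.all⁺ (R s) ss (T-∧⁻ˡ {all (R s) ss} h) ∷ pairsOK⇒AllPairs ss (T-∧⁻ʳ {all (R s) ss} h)

    module _ {x : Fin n} {s t : Subset n} (s∩t≡x : s ∩ t ≡ ⁅ x ⁆) where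

      kernel∈ˡ : x ∈ s
      kernel∈ˡ = proj₁ (x∈p∩q⁻ s t (subst (x ∈_) (sym s∩t≡x) (x∈⁅x⁆ x)))

      kernel∈ʳ : x ∈ t
      kernel∈ʳ = proj₂ (x∈p∩q⁻ s t (subst (x ∈_) (sym s∩t≡x) (x∈⁅x⁆ x)))

      common⇒kernel : ∀ {y} → y ∈ s → y ∈ t → y ≡ x
      common⇒kernel y∈s y∈t = x∈⁅y⁆⇒x≡y x (subst (_ ∈_) s∩t≡x (x∈p∩q⁺ (y∈s , y∈t)))

    Star⇒kernel∈ : ∀ {x} {S T Ss} → Star x (S ∷ T ∷ Ss) → All (x ∈_) (S ∷ T ∷ Ss)
    Star⇒kernel∈ ((S∩T ∷ S∩Ss) ∷ _) = kernel∈ˡ S∩T ∷ kernel∈ʳ S∩T ∷ All-map kernel∈ʳ S∩Ss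

    kernel-sets-≥ : ∀ {x : Fin n} r F → All (x ∈_) F →
      #supersets (λ i → does (i ≟ᶠ x)) r ≤ count (λ e → lookup e x) (admissible n r F) + length F
    kernel-sets-≥ {x} r F x∈F = begin
      #supersets D r
        ≤⟨ count-fresh (λ e → hasSize r e ∧ containsAll D e) F ⟩
      count (λ e → (hasSize r e ∧ containsAll D e) ∧ fresh F e) (allSubsets n) + length F
        ≤⟨ ℕ.+-monoˡ-≤ (length F) (count-mono (allSubsets n) admissible-kernel) ⟩
      count (λ e → hasSize r e ∧ ((fresh F e ∧ all (meets e) F) ∧ lookup e x)) (allSubsets n) + length F
        ≡⟨ cong (_+ length F) (count-admissible r F (λ e → lookup e x)) ⟨
      count (λ e → lookup e x) (admissible n r F) + length F ∎
      where
      open ℕ.≤-Reasoning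
      D = λ i → does (i ≟ᶠ x)
      admissible-kernel : ∀ {e} → T ((hasSize r e ∧ containsAll D e) ∧ fresh F e) →
                          T (hasSize r e ∧ ((fresh F e ∧ all (meets e) F) ∧ lookup e x))
      admissible-kernel {e} h = T-∧⁺ (T-∧⁻ˡ {hasSize r e} size∧D) (T-∧⁺ (T-∧⁺ (T-∧⁻ʳ {hasSize r e ∧ containsAll D e} h) meets-F) x∈e)
        where
        size∧D = T-∧⁻ˡ {hasSize r e ∧ containsAll D e} h
        x∈e : T (lookup e x)
        x∈e = containsAll⁻ D e (T-∧⁻ʳ {hasSize r e} size∧D) x (subst T (sym (dec-true (x ≟ᶠ x) refl)) tt)
        meets-F : T (all (meets e) F)
        meets-F = All.all⁻ (meets e) (All-map (meets⁺ (T-lookup⇒∈ x∈e)) x∈F)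

    module _ (x : Fin n) where

      open import Data.List.Membership.DecPropositional (_≟ᶠ_ {n}) using (_∈?_)

      pointsExcept : Subset n → List (Fin n)
      pointsExcept S = filter (λ y → T? (lookup S y ∧ not (does (y ≟ᶠ x)))) (allFin n)

      length-pointsExcept : ∀ S → length (pointsExcept S) ≤ ∣ S ∣
      length-pointsExcept S = begin
        length (pointsExcept S)                       ≡⟨ count-true (pointsExcept S) ⟨
        count (λ _ → true) (pointsExcept S)           ≡⟨ count-filter _ (λ _ → true) (allFin n) ⟩
        count (λ y → (lookup S y ∧ not (does (y ≟ᶠ x))) ∧ true) (allFin n)
          ≤⟨ count-mono (allFin n) (λ {y} h → T-∧⁻ˡ {lookup S y} (T-∧⁻ˡ {lookup S y ∧ not (does (y ≟ᶠ x))} h)) ⟩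
        count (lookup S) (allFin n)                   ≡⟨ count-tabulate (lookup S) (λ i → i) ⟩
        countFin (lookup S)                           ≡⟨ countFin-lookup S ⟩
        ∣ S ∣                                         ∎
        where open ℕ.≤-Reasoning

      ∈-pointsExcept⁺ : ∀ {y S} → y ∈ S → y ≢ x → y ∈ˡ pointsExcept S
      ∈-pointsExcept⁺ {y} y∈S y≢x = ∈-filter⁺ _ (∈-allFin y) (T-∧⁺ (∈⇒T-lookup y∈S) not-y≟x)
        where
        not-y≟x : T (not (does (y ≟ᶠ x)))
        not-y≟x = subst (T ∘ not) (sym (dec-false (y ≟ᶠ x) y≢x)) tt

      ∈-pointsExcept⁻ : ∀ {y S} → y ∈ˡ pointsExcept S → y ∈ S × y ≢ x
      ∈-pointsExcept⁻ {y} {S} y∈P with proj₂ (∈-filter⁻ (λ y → T? (lookup S y ∧ not (does (y ≟ᶠ x)))) {xs = allFin n} y∈P)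
      ... | h = T-lookup⇒∈ (T-∧⁻ˡ {lookup S y} h) , λ y≡x → subst (T ∘ not) (dec-true (y ≟ᶠ x) y≡x) (T-∧⁻ʳ {lookup S y} h)

      avoidsKernel : ℕ → List (Subset n) → Subset n → Bool
      avoidsKernel r Ss e = hasSize r e ∧ (not (lookup e x) ∧ all (meets e) Ss)

      module _ (r b k : ℕ)
        (bound : ∀ {ds} → Unique ds → length ds ≡ k → #supersets (λ i → does (i ∈? ds)) r ≤ b) where

        -- as holds the points at which e meets the star members already handled,
        -- one for each; they avoid x, so they are distinct and lie outside the
        -- remaining members.
        kernel-avoiders-≤ : ∀ Ss as → Star x Ss → All (λ S → ∣ S ∣ ≡ r) Ss →
          Unique as → All (λ a → All (a ∉_) Ss) as → length as + length Ss ≡ k →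
          count (λ e → avoidsKernel r Ss e ∧ all (lookup e) as) (allSubsets n) ≤ r ^ length Ss * b
        kernel-avoiders-≤ [] as _ _ unique _ len = begin
          count (λ e → avoidsKernel r [] e ∧ all (lookup e) as) (allSubsets n)
            ≤⟨ count-mono (allSubsets n) (λ {e} h → T-∧⁺ (T-∧⁻ˡ {hasSize r e} (T-∧⁻ˡ {avoidsKernel r [] e} h))
                                                         (containsAll⁺ _ e (member {e} (T-∧⁻ʳ {avoidsKernel r [] e} h)))) ⟩
          #supersets (λ i → does (i ∈? as)) r
            ≤⟨ bound unique (trans (sym (ℕ.+-identityʳ (length as))) len) ⟩
          b ≡⟨ ℕ.*-identityˡ b ⟨
          1 * b ∎
          where
          open ℕ.≤-Reasoning
          member : ∀ {e} → T (all (lookup e) as) → ∀ i → T (does (i ∈? as)) → T (lookup e i)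
          member {e} all-as i i∈as with i ∈? as
          ... | yes i∈ = All-lookup (All.all⁺ (lookup e) as all-as) i∈
        kernel-avoiders-≤ (S ∷ Ss) as (S∩Ss ∷ star) (∣S∣ ∷ sizes) unique as∉ len = begin
          count (λ e → avoidsKernel r (S ∷ Ss) e ∧ all (lookup e) as) (allSubsets n)
            ≤⟨ union-bound _ (λ a e → lookup e a) (allSubsets n) (pointsExcept S) (r ^ length Ss * b) (λ {e} → covered {e}) (λ {a} → bounded {a}) ⟩
          length (pointsExcept S) * (r ^ length Ss * b)
            ≤⟨ ℕ.*-monoˡ-≤ (r ^ length Ss * b) (subst (length (pointsExcept S) ≤_) ∣S∣ (length-pointsExcept S)) ⟩
          r * (r ^ length Ss * b) ≡⟨ ℕ.*-assoc r (r ^ length Ss) b ⟨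
          r ^ length (S ∷ Ss) * b ∎
          where
          open ℕ.≤-Reasoning
          covered : ∀ {e} → T (avoidsKernel r (S ∷ Ss) e ∧ all (lookup e) as) → Any (λ a → T (lookup e a)) (pointsExcept S)
          covered {e} h with meets⁻ {e = e} {s = S} (T-∧⁻ˡ {meets e S} (T-∧⁻ʳ {not (lookup e x)} rest))
            where rest = T-∧⁻ʳ {hasSize r e} (T-∧⁻ˡ {avoidsKernel r (S ∷ Ss) e} h)
          ... | y , y∈e , y∈S = lose (∈-pointsExcept⁺ y∈S y≢x) (∈⇒T-lookup y∈e)
            where
            x∉e : T (not (lookup e x))
            x∉e = T-∧⁻ˡ {not (lookup e x)} (T-∧⁻ʳ {hasSize r e} (T-∧⁻ˡ {avoidsKernel r (S ∷ Ss) e} h))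
            y≢x : y ≢ x
            y≢x refl = T-not⇒¬T x∉e (∈⇒T-lookup y∈e)
          bounded : ∀ {a} → a ∈ˡ pointsExcept S →
            count (λ e → (avoidsKernel r (S ∷ Ss) e ∧ all (lookup e) as) ∧ lookup e a) (allSubsets n) ≤ r ^ length Ss * b
          bounded {a} a∈P = ℕ.≤-trans (count-mono {q = λ e → avoidsKernel r Ss e ∧ all (lookup e) (a ∷ as)} (allSubsets n) (λ {e} → drop-S {e}))
            (kernel-avoiders-≤ Ss (a ∷ as) star sizes (a∉as ∷ unique) (a∉Ss ∷ All-map All-tail as∉)
                        (trans (sym (ℕ.+-suc (length as) (length Ss))) len))
            where
            a∈S = proj₁ (∈-pointsExcept⁻ {S = S} a∈P)
            a≢x = proj₂ (∈-pointsExcept⁻ {S = S} a∈P)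
            a∉as : All (a ≢_) as
            a∉as = All-map (λ a′∉S∷Ss a≡a′ → All-head a′∉S∷Ss (subst (_∈ S) a≡a′ a∈S)) as∉
            a∉Ss : All (a ∉_) Ss
            a∉Ss = All-map (λ S∩T a∈T → a≢x (common⇒kernel S∩T a∈S a∈T)) S∩Ss
            drop-S : ∀ {e} → T ((avoidsKernel r (S ∷ Ss) e ∧ all (lookup e) as) ∧ lookup e a) →
                     T (avoidsKernel r Ss e ∧ all (lookup e) (a ∷ as))
            drop-S {e} h = T-∧⁺ (T-∧⁺ (T-∧⁻ˡ {hasSize r e} ak) (T-∧⁺ (T-∧⁻ˡ {not (lookup e x)} rest) meets-Ss))
                                (T-∧⁺ (T-∧⁻ʳ {avoidsKernel r (S ∷ Ss) e ∧ all (lookup e) as} h) (T-∧⁻ʳ {avoidsKernel r (S ∷ Ss) e} ak∧as))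
              where
              ak∧as = T-∧⁻ˡ {avoidsKernel r (S ∷ Ss) e ∧ all (lookup e) as} h
              ak = T-∧⁻ˡ {avoidsKernel r (S ∷ Ss) e} ak∧as
              rest = T-∧⁻ʳ {hasSize r e} ak
              meets-Ss = T-∧⁻ʳ {meets e S} (T-∧⁻ʳ {not (lookup e x)} rest)

module Binomials where

  open import Data.Nat using (ℕ; zero; suc; _+_; _*_; _^_; _∸_; _≤_; _<_; z≤n; s≤s)
  open import Data.Nat.Combinatorics using (_C_; nCk+nC[k+1]≡[n+1]C[k+1]; nC1≡n)
  import Data.Nat.Properties as ℕ
  open import Data.Nat.Solver using (module +-*-Solver)
  open import Data.Empty using (⊥-elim)
  open import Relation.Nullary using (yes; no)
  open import Relation.Binary.PropositionalEquality using (_≡_; refl; sym; trans; cong; cong₂; module ≡-Reasoning)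

  open +-*-Solver

  pascal : ∀ m k → suc m C suc k ≡ m C k + m C suc k
  pascal m k = sym (nCk+nC[k+1]≡[n+1]C[k+1] m k)

  C-pos : ∀ {m k} → k ≤ m → 1 ≤ m C k
  C-pos {m}     {zero}  _         = ℕ.≤-refl
  C-pos {suc m} {suc k} (s≤s k≤m) = ℕ.≤-trans (C-pos k≤m) (ℕ.≤-trans (ℕ.m≤m+n _ _) (ℕ.≤-reflexive (sym (pascal m k))))

  m≤mCk : ∀ {m k} → 1 ≤ k → k < m → m ≤ m C k
  m≤mCk {suc m} {suc zero}    _ _ = ℕ.≤-reflexive (sym (nC1≡n (suc m)))
  m≤mCk {suc m} {suc (suc k)} _ (s≤s k<m) = begin
    suc m                         ≡⟨ ℕ.+-comm 1 m ⟩
    m + 1                         ≤⟨ ℕ.+-mono-≤ (m≤mCk (s≤s z≤n) k<m) (C-pos k<m) ⟩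
    m C suc k + m C suc (suc k)   ≡⟨ pascal m (suc k) ⟨
    suc m C suc (suc k)           ∎
    where open ℕ.≤-Reasoning

  C-absorb : ∀ m k → suc k * (suc m C suc k) ≡ suc m * (m C k)
  C-absorb zero    zero    = refl
  C-absorb zero    (suc k) = ℕ.*-zeroʳ (suc (suc k))
  C-absorb (suc m) zero    = trans (ℕ.*-identityˡ _) (trans (nC1≡n (suc (suc m))) (sym (ℕ.*-identityʳ (suc (suc m)))))
  C-absorb (suc m) (suc k) = begin
    suc (suc k) * (suc (suc m) C suc (suc k))                  ≡⟨ cong (suc (suc k) *_) (pascal (suc m) (suc k)) ⟩
    suc (suc k) * (suc m C suc k + suc m C suc (suc k))        ≡⟨ ℕ.*-distribˡ-+ (suc (suc k)) (suc m C suc k) _ ⟩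
    suc (suc k) * (suc m C suc k) + suc (suc k) * (suc m C suc (suc k))
        ≡⟨ cong₂ _+_ (cong (suc m C suc k +_) (C-absorb m k)) (C-absorb m (suc k)) ⟩
    suc m C suc k + suc m * (m C k) + suc m * (m C suc k)      ≡⟨ solve 4 (λ c m a b → c :+ m :* a :+ m :* b := c :+ m :* (a :+ b)) refl (suc m C suc k) (suc m) (m C k) (m C suc k) ⟩
    suc m C suc k + suc m * (m C k + m C suc k)                ≡⟨ cong (λ t → suc m C suc k + suc m * t) (pascal m k) ⟨
    suc (suc m) * (suc m C suc k)                              ∎
    where open ≡-Reasoning

  C-absorb³ : ∀ m k → (1 + k) * ((2 + k) * ((3 + k) * ((3 + m) C (3 + k))))
                    ≡ (1 + m) * ((2 + m) * ((3 + m) * (m C k)))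
  C-absorb³ m k = begin
    (1 + k) * ((2 + k) * ((3 + k) * ((3 + m) C (3 + k))))  ≡⟨ cong (λ t → (1 + k) * ((2 + k) * t)) (C-absorb (2 + m) (2 + k)) ⟩
    (1 + k) * ((2 + k) * ((3 + m) * ((2 + m) C (2 + k))))  ≡⟨ solve 4 (λ a b c x → a :* (b :* (c :* x)) := c :* (a :* (b :* x))) refl (1 + k) (2 + k) (3 + m) ((2 + m) C (2 + k)) ⟩
    (3 + m) * ((1 + k) * ((2 + k) * ((2 + m) C (2 + k))))  ≡⟨ cong (λ t → (3 + m) * ((1 + k) * t)) (C-absorb (1 + m) (1 + k)) ⟩
    (3 + m) * ((1 + k) * ((2 + m) * ((1 + m) C (1 + k))))  ≡⟨ solve 4 (λ c a b x → c :* (a :* (b :* x)) := b :* (c :* (a :* x))) refl (3 + m) (1 + k) (2 + m) ((1 + m) C (1 + k)) ⟩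
    (2 + m) * ((3 + m) * ((1 + k) * ((1 + m) C (1 + k))))  ≡⟨ cong (λ t → (2 + m) * ((3 + m) * t)) (C-absorb m k) ⟩
    (2 + m) * ((3 + m) * ((1 + m) * (m C k)))              ≡⟨ solve 4 (λ b c a x → b :* (c :* (a :* x)) := a :* (b :* (c :* x))) refl (2 + m) (3 + m) (1 + m) (m C k) ⟩
    (1 + m) * ((2 + m) * ((3 + m) * (m C k)))              ∎
    where open ≡-Reasoning

  C[n∸4,r∸4]*n³≤64r³C[n∸1,r∸1] : ∀ n r → 4 ≤ n → 4 ≤ r →
    ((n ∸ 4) C (r ∸ 4)) * n ^ 3 ≤ 64 * r ^ 3 * ((n ∸ 1) C (r ∸ 1))
  C[n∸4,r∸4]*n³≤64r³C[n∸1,r∸1] (suc (suc (suc (suc a)))) (suc (suc (suc (suc b)))) (s≤s (s≤s (s≤s (s≤s _)))) (s≤s (s≤s (s≤s (s≤s _)))) = begin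
    (a C b) * n ^ 3                                             ≤⟨ ℕ.*-monoʳ-≤ (a C b) n³≤ ⟩
    (a C b) * (64 * ((1 + a) * ((2 + a) * (3 + a))))            ≡⟨ solve 4 (λ x p q s → x :* (con 64 :* (p :* (q :* s))) := con 64 :* (p :* (q :* (s :* x)))) refl (a C b) (1 + a) (2 + a) (3 + a) ⟩
    64 * ((1 + a) * ((2 + a) * ((3 + a) * (a C b))))            ≡⟨ cong (64 *_) (C-absorb³ a b) ⟨
    64 * ((1 + b) * ((2 + b) * ((3 + b) * ((3 + a) C (3 + b))))) ≤⟨ ℕ.*-monoʳ-≤ 64 b³≤r³ ⟩
    64 * (r ^ 3 * ((3 + a) C (3 + b)))                          ≡⟨ ℕ.*-assoc 64 (r ^ 3) ((3 + a) C (3 + b)) ⟨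
    64 * r ^ 3 * ((3 + a) C (3 + b))                            ∎
    where
    open ℕ.≤-Reasoning
    n = 4 + a
    r = 4 + b
    n≤4[i+a] : ∀ i → n ≤ 4 * (suc i + a)
    n≤4[i+a] i = begin
      4 + a         ≤⟨ ℕ.+-monoʳ-≤ 4 (ℕ.m≤n*m a 4) ⟩
      4 + 4 * a     ≡⟨ solve 1 (λ a → con 4 :+ con 4 :* a := con 4 :* (con 1 :+ a)) refl a ⟩
      4 * (1 + a)   ≤⟨ ℕ.*-monoʳ-≤ 4 (ℕ.+-monoˡ-≤ a (s≤s z≤n)) ⟩
      4 * (suc i + a) ∎
    n³≤ : n ^ 3 ≤ 64 * ((1 + a) * ((2 + a) * (3 + a)))
    n³≤ = ℕ.≤-trans (ℕ.*-mono-≤ (n≤4[i+a] 0) (ℕ.*-mono-≤ (n≤4[i+a] 1) (ℕ.*-mono-≤ (n≤4[i+a] 2) (ℕ.≤-refl {1}))))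
                    (ℕ.≤-reflexive (solve 1 (λ a → (con 4 :* (con 1 :+ a)) :* ((con 4 :* (con 2 :+ a)) :* ((con 4 :* (con 3 :+ a)) :* con 1))
                                                := con 64 :* ((con 1 :+ a) :* ((con 2 :+ a) :* (con 3 :+ a)))) refl a))
    b³≤r³ : (1 + b) * ((2 + b) * ((3 + b) * ((3 + a) C (3 + b)))) ≤ r ^ 3 * ((3 + a) C (3 + b))
    b³≤r³ = ℕ.≤-trans (ℕ.≤-reflexive (solve 4 (λ p q s x → p :* (q :* (s :* x)) := (p :* (q :* (s :* con 1))) :* x) refl (1 + b) (2 + b) (3 + b) ((3 + a) C (3 + b))))
                      (ℕ.*-monoˡ-≤ ((3 + a) C (3 + b)) (ℕ.*-mono-≤ (ℕ.m≤n+m (1 + b) 3) (ℕ.*-mono-≤ (ℕ.m≤n+m (2 + b) 2) (ℕ.*-mono-≤ (ℕ.m≤n+m (3 + b) 1) (ℕ.≤-refl {1})))))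

  r⁸≤n³⇒r²≤n : ∀ n r → r ^ 8 ≤ n ^ 3 → r * r ≤ n
  r⁸≤n³⇒r²≤n n r r⁸≤n³ with r * r ℕ.≤? n
  ... | yes r²≤n = r²≤n
  ... | no  r²≰n = ⊥-elim (ℕ.<-irrefl refl (begin-strict
    n ^ 3          <⟨ ℕ.^-monoˡ-< 3 (ℕ.n<1+n n) ⟩
    suc n ^ 3      ≤⟨ ℕ.m≤n*m (suc n ^ 3) (suc n) ⟩
    suc n ^ 4      ≤⟨ ℕ.^-monoˡ-≤ 4 (ℕ.≰⇒> r²≰n) ⟩
    (r * r) ^ 4    ≡⟨ solve 1 (λ r → (r :* r) :^ 4 := r :^ 8) refl r ⟩
    r ^ 8          ≤⟨ r⁸≤n³ ⟩
    n ^ 3          ∎))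
    where open ℕ.≤-Reasoning

  6r+9≤n : ∀ n r → 100 ≤ n → r * r ≤ n → 6 * r + 9 ≤ n
  6r+9≤n n r 100≤n r²≤n with r ℕ.≤? 15
  ... | yes r≤15 = ℕ.≤-trans (ℕ.+-monoˡ-≤ 9 (ℕ.*-monoʳ-≤ 6 r≤15)) (ℕ.≤-trans (ℕ.m≤n+m 99 1) 100≤n)
  ... | no  r≰15 = begin
    6 * r + 9      ≤⟨ ℕ.+-monoʳ-≤ (6 * r) (ℕ.≤-trans (ℕ.m≤n+m 9 7) (ℕ.≤-trans 16≤r (ℕ.m≤m*n r 10))) ⟩
    6 * r + r * 10 ≡⟨ solve 1 (λ r → con 6 :* r :+ r :* con 10 := con 16 :* r) refl r ⟩
    16 * r         ≤⟨ ℕ.*-monoˡ-≤ r 16≤r ⟩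
    r * r          ≤⟨ r²≤n ⟩
    n              ∎
    where
    open ℕ.≤-Reasoning
    16≤r : 16 ≤ r
    16≤r = ℕ.≰⇒> r≰15

  m[r⁴c]n³≤384r⁸L : ∀ {n r m c G L} → m ≤ 3 * r → c * n ^ 3 ≤ 64 * r ^ 3 * G → G ≤ 2 * L →
    m * (r ^ 4 * c) * n ^ 3 ≤ 384 * r ^ 8 * L
  m[r⁴c]n³≤384r⁸L {n} {r} {m} {c} {G} {L} m≤3r cn³≤ G≤2L = begin
    m * (r ^ 4 * c) * n ^ 3          ≤⟨ ℕ.*-monoˡ-≤ (n ^ 3) (ℕ.*-monoˡ-≤ (r ^ 4 * c) m≤3r) ⟩
    3 * r * (r ^ 4 * c) * n ^ 3      ≡⟨ solve 3 (λ r c n3 → con 3 :* r :* (r :^ 4 :* c) :* n3 := con 3 :* r :^ 5 :* (c :* n3)) refl r c (n ^ 3) ⟩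
    3 * r ^ 5 * (c * n ^ 3)          ≤⟨ ℕ.*-monoʳ-≤ (3 * r ^ 5) cn³≤ ⟩
    3 * r ^ 5 * (64 * r ^ 3 * G)     ≤⟨ ℕ.*-monoʳ-≤ (3 * r ^ 5) (ℕ.*-monoʳ-≤ (64 * r ^ 3) G≤2L) ⟩
    3 * r ^ 5 * (64 * r ^ 3 * (2 * L)) ≡⟨ solve 2 (λ r L → con 3 :* r :^ 5 :* (con 64 :* r :^ 3 :* (con 2 :* L)) := con 384 :* r :^ 8 :* L) refl r L ⟩
    384 * r ^ 8 * L                  ∎
    where open ℕ.≤-Reasoning

module Kernel where

  open import Defs
  open Counting
  open Averaging
  open Process
  open Survival
  open Supersets
  open Admissible
  open Stars
  open Binomials
  open import Data.Bool using (Bool; true; T; T?; not; _∧_)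
  open import Data.Bool.ListAction using (all)
  open import Data.Fin using (Fin; zero; suc) renaming (_≟_ to _≟ᶠ_)
  open import Data.Fin.Subset using (Subset; ∣_∣; _∈_)
  open import Data.Empty using (⊥-elim)
  open import Data.List using (List; []; _∷_; _++_; [_]; length)
  import Data.List.Properties as List
  import Data.List.Relation.Unary.AllPairs as AllPairs
  open import Data.List.Relation.Unary.Unique.Propositional using (Unique)
  open import Data.List.Relation.Unary.All using (All; []; _∷_) renaming (head to All-head; tail to All-tail)
  import Data.List.Relation.Unary.All.Properties as All
  open import Data.Nat using (ℕ; zero; suc; pred; >-nonZero; _+_; _*_; _^_; _∸_; _⊔_; _≤_; _<_; z≤n; s≤s)
  import Data.Nat.Properties as ℕ
  open import Data.Nat.Combinatorics using (_C_)
  open import Data.Nat.Solver using (module +-*-Solver)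
  open import Data.Product using (∃; _×_; _,_; proj₂)
  open import Data.Rational using (ℚ; 0ℚ; 1ℚ; _-_; nonNegative)
  import Data.Rational as Q
  import Data.Rational.Properties as ℚ
  open import Data.Rational.Solver using () renaming (module +-*-Solver to ℚ-Solver)
  open import Relation.Nullary using (does; Dec; yes; no)
  open import Data.Integer using (+_)
  open import Data.Vec using (lookup)
  open import Relation.Nullary.Decidable using (fromWitness; dec-false)
  open import Function using (_∘_)
  open import Relation.Binary.PropositionalEquality using (_≡_; _≢_; refl; sym; trans; cong; cong₂; subst)

  𝟙-true : ∀ {b} → T b → 𝟙 b ≡ 1ℚ
  𝟙-true {true} _ = refl

  mp≤ε : ∀ {m U L N K : ℕ} {p ε : ℚ} → 1 ≤ L * N → p Q.* toℚ L ≡ toℚ U →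
    m * U * N ≤ K * L → toℚ K Q.≤ ε Q.* toℚ N → toℚ m Q.* p Q.≤ ε
  mp≤ε {m} {U} {L} {N} {K} {p} {ε} 1≤LN pL≡U mUN≤KL K≤εN =
    ℚ.*-cancelʳ-≤-pos (toℚ L Q.* toℚ N) {{Q.positive (subst (0ℚ Q.<_) (toℚ-* L N) (toℚ-pos 1≤LN))}} (begin
      toℚ m Q.* p Q.* (toℚ L Q.* toℚ N)   ≡⟨ solve 4 (λ m p l n → m :* p :* (l :* n) := m :* (p :* l) :* n) refl (toℚ m) p (toℚ L) (toℚ N) ⟩
      toℚ m Q.* (p Q.* toℚ L) Q.* toℚ N   ≡⟨ cong (λ u → toℚ m Q.* u Q.* toℚ N) pL≡U ⟩
      toℚ m Q.* toℚ U Q.* toℚ N           ≡⟨ cong (Q._* toℚ N) (toℚ-* m U) ⟨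
      toℚ (m * U) Q.* toℚ N               ≡⟨ toℚ-* (m * U) N ⟨
      toℚ (m * U * N)                     ≤⟨ toℚ-mono-≤ mUN≤KL ⟩
      toℚ (K * L)                         ≡⟨ toℚ-* K L ⟩
      toℚ K Q.* toℚ L                     ≤⟨ ℚ.*-monoʳ-≤-nonNeg (toℚ L) {{nonNegative (toℚ-nonNeg L)}} K≤εN ⟩
      ε Q.* toℚ N Q.* toℚ L               ≡⟨ solve 3 (λ e n l → e :* n :* l := e :* (l :* n)) refl ε (toℚ N) (toℚ L) ⟩
      ε Q.* (toℚ L Q.* toℚ N)             ∎)
    where
    open ℚ.≤-Reasoning
    open ℚ-Solver

  2≤-from-≢ : ∀ {k} → k ≢ 0 → k ≢ 1 → 2 ≤ k
  2≤-from-≢ {zero}        k≢0 _   = ⊥-elim (k≢0 refl)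
  2≤-from-≢ {suc zero}    _   k≢1 = ⊥-elim (k≢1 refl)
  2≤-from-≢ {suc (suc k)} _   _   = s≤s (s≤s z≤n)

  module KernelSurvival (n r m : ℕ) (ε : ℚ)
    (m≤3r : m ≤ 3 * r) (6r+9≤n : 6 * r + 9 ≤ n)
    {x : Fin n} {S₁ S₂ S₃ S₄ : Subset n}
    (star : Star x (S₁ ∷ S₂ ∷ S₃ ∷ S₄ ∷ []))
    (sizes : All (λ S → ∣ S ∣ ≡ r) (S₁ ∷ S₂ ∷ S₃ ∷ S₄ ∷ []))
    (S₁≢S₂ : S₁ ≢ S₂)
    where

    open import Data.List.Membership.DecPropositional (_≟ᶠ_ {n}) using (_∈?_)

    F₀ : List (Subset n)
    F₀ = S₁ ∷ S₂ ∷ S₃ ∷ S₄ ∷ []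

    x∈F₀ : All (x ∈_) F₀
    x∈F₀ = Star⇒kernel∈ star

    2≤r : 2 ≤ r
    2≤r = 2≤-from-≢ (λ r≡0 → size-0⇒∉ (trans ∣S₁∣≡r r≡0) x∈S₁)
                    (λ r≡1 → S₁≢S₂ (trans (size-1⇒singleton (trans ∣S₁∣≡r r≡1) x∈S₁)
                                          (sym (size-1⇒singleton (trans ∣S₂∣≡r r≡1) x∈S₂))))
      where
      ∣S₁∣≡r = All-head sizes
      ∣S₂∣≡r = All-head (All-tail sizes)
      x∈S₁ = All-head x∈F₀
      x∈S₂ = All-head (All-tail x∈F₀)

    D : Fin n → Bool
    D i = does (i ≟ᶠ x)

    G : ℕ
    G = #supersets D r

    G≡ : G ≡ (n ∸ 1) C (r ∸ 1)
    G≡ = trans (#supersets-≥ D r (subst (_≤ r) (sym (countFin-≟ x)) (ℕ.≤-trans (s≤s z≤n) 2≤r)))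
               (cong₂ _C_ (trans (countFin-not D) (cong (n ∸_) (countFin-≟ x))) (cong (r ∸_) (countFin-≟ x)))

    2[4+m]≤G : (4 + m) + (4 + m) ≤ G
    2[4+m]≤G = begin
      (4 + m) + (4 + m)    ≤⟨ ℕ.+-mono-≤ 4+m≤3r+4 4+m≤3r+4 ⟩
      (3 * r + 4) + (3 * r + 4) ≡⟨ solve 1 (λ r → (con 3 :* r :+ con 4) :+ (con 3 :* r :+ con 4) := con 6 :* r :+ con 8) refl r ⟩
      6 * r + 8            ≤⟨ ℕ.m+n≤o⇒m≤o∸n (6 * r + 8) (subst (_≤ n) (sym (ℕ.+-assoc (6 * r) 8 1)) 6r+9≤n) ⟩
      n ∸ 1                ≤⟨ m≤mCk (ℕ.∸-monoˡ-≤ 1 2≤r) (ℕ.∸-monoˡ-< r<n (ℕ.≤-trans (s≤s z≤n) 2≤r)) ⟩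
      (n ∸ 1) C (r ∸ 1)    ≡⟨ G≡ ⟨
      G                    ∎
      where
      open ℕ.≤-Reasoning
      open +-*-Solver
      4+m≤3r+4 : 4 + m ≤ 3 * r + 4
      4+m≤3r+4 = subst (4 + m ≤_) (ℕ.+-comm 4 (3 * r)) (ℕ.+-monoʳ-≤ 4 m≤3r)
      r<n : r < n
      r<n = ℕ.≤-trans (s≤s (ℕ.≤-trans (ℕ.m≤n*m r 6) (ℕ.m≤m+n (6 * r) 8))) (subst (_≤ n) (ℕ.+-suc (6 * r) 8) 6r+9≤n)

    L : ℕ
    L = G ∸ (4 + m)

    4+m≤L : 4 + m ≤ L
    4+m≤L = ℕ.m+n≤o⇒m≤o∸n (4 + m) 2[4+m]≤G

    1≤L : 1 ≤ L
    1≤L = ℕ.≤-trans (s≤s z≤n) 4+m≤L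

    G≤2L : G ≤ 2 * L
    G≤2L = begin
      G                ≡⟨ ℕ.m∸n+n≡m (ℕ.≤-trans (ℕ.m≤m+n (4 + m) (4 + m)) 2[4+m]≤G) ⟨
      L + (4 + m)      ≤⟨ ℕ.+-monoʳ-≤ L 4+m≤L ⟩
      L + L            ≡⟨ cong (λ l → L + l) (ℕ.+-identityʳ L) ⟨
      2 * L            ∎
      where open ℕ.≤-Reasoning

    Good : List (Subset n) → Set
    Good F = (∃ λ rest → F ≡ F₀ ++ rest) × All (x ∈_) F

    Good-step : ∀ {F e} → Good F → T (lookup e x) → Good (F ++ [ e ])
    Good-step {e = e} ((rest , refl) , x∈F) x∈e =
      (rest ++ [ e ] , List.++-assoc F₀ rest [ e ]) , All.++⁺ x∈F (T-lookup⇒∈ x∈e ∷ [])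

    gP : List (Subset n) → ℚ
    gP F = 𝟙 (A4 F ∧ B (3 * r) F)

    Good⇒gP≡1 : (T (isStar F₀)) → ∀ {F} → Good F → gP F ≡ 1ℚ
    Good⇒gP≡1 isStar-F₀ ((rest , refl) , x∈F) = 𝟙-true (T-∧⁺ isStar-F₀ (fromWitness (x , kernel∈⋂ (3 * r) _ x∈F)))

    kernel-stays : ∀ {F} → Good F → length F ≤ 4 + m → L ≤ count (λ e → lookup e x) (admissible n r F)
    kernel-stays {F} (_ , x∈F) |F|≤4+m = ℕ.≤-trans (ℕ.∸-monoʳ-≤ G |F|≤4+m)
      (ℕ.m≤n+o⇒m∸n≤o G (length F) (subst (G ≤_) (ℕ.+-comm _ (length F)) (kernel-sets-≥ r F x∈F)))

    module _ (b : ℕ) (bound : ∀ {ds} → Unique ds → length ds ≡ 4 → #supersets (λ i → does (i ∈? ds)) r ≤ b) where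

      kernel-leaves : ∀ {F} → Good F → count (λ e → not (lookup e x)) (admissible n r F) ≤ r ^ 4 * b
      kernel-leaves {F} ((rest , refl) , _) = begin
        count (λ e → not (lookup e x)) (admissible n r F)  ≡⟨ count-admissible r F (λ e → not (lookup e x)) ⟩
        count (λ e → hasSize r e ∧ ((fresh F e ∧ all (meets e) F) ∧ not (lookup e x))) (allSubsets n)
          ≤⟨ count-mono (allSubsets n) (λ {e} → forget-rest {e}) ⟩
        count (λ e → avoidsKernel x r F₀ e ∧ all (lookup e) []) (allSubsets n)
          ≤⟨ kernel-avoiders-≤ x r b 4 bound F₀ [] star sizes AllPairs.[] [] refl ⟩
        r ^ 4 * b ∎
        where
        open ℕ.≤-Reasoning
        forget-rest : ∀ {e} → T (hasSize r e ∧ ((fresh F e ∧ all (meets e) F) ∧ not (lookup e x))) →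
                      T (avoidsKernel x r F₀ e ∧ true)
        forget-rest {e} h = T-∧⁺ (T-∧⁺ (T-∧⁻ˡ {hasSize r e} h) (T-∧⁺ (T-∧⁻ʳ {fresh F e ∧ all (meets e) F} rest′) meets-F₀)) _
          where
          rest′ = T-∧⁻ʳ {hasSize r e} h
          meets-F₀ : T (all (meets e) F₀)
          meets-F₀ = All.all⁻ (meets e) (All.++⁻ˡ F₀ (All.all⁺ (meets e) F (T-∧⁻ʳ {fresh F e} (T-∧⁻ˡ {fresh F e ∧ all (meets e) F} rest′))))

      survives-with : T (isStar F₀) → m * (r ^ 4 * b) * n ^ 3 ≤ 384 * r ^ 8 * L →
                      toℚ (384 * r ^ 8) Q.≤ ε Q.* toℚ (n ^ 3) → 1ℚ - ε Q.≤ runExp n r m F₀ gP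
      survives-with isStar-F₀ numeric r⁸-small = ℚ.≤-trans 1-ε≤1-mp
        (survival n r (λ e → lookup e x) Good Good-step (4 + m) p 0≤p hazard m F₀ (([] , refl) , x∈F₀) ℕ.≤-refl
                  (λ good → ℚ.≤-reflexive (sym (Good⇒gP≡1 isStar-F₀ good))) (λ F → 𝟙-nonNeg _))
        where
        U = r ^ 4 * b
        -- At most U admissible sets avoid x, out of at least L.
        p : ℚ
        p = (+ U) Q./ suc (pred L)
        pL≡U : p Q.* toℚ L ≡ toℚ U
        pL≡U = trans (cong (λ l → p Q.* toℚ l) (sym (ℕ.suc-pred L {{>-nonZero 1≤L}}))) (/-*-cancel U (pred L))
        0≤p : 0ℚ Q.≤ p
        0≤p = ℚ.nonNegative⁻¹ p {{ℚ.normalize-nonNeg U (suc (pred L))}}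
        hazard : ∀ {F} → Good F → length F < 4 + m →
          1 ≤ length (admissible n r F) ×
          toℚ (count (λ e → not (lookup e x)) (admissible n r F)) Q.≤ p Q.* toℚ (length (admissible n r F))
        hazard {F} good |F|<4+m = ℕ.≤-trans 1≤L L≤|A| ,
          ℚ.≤-trans (toℚ-mono-≤ (kernel-leaves good))
            (ℚ.≤-trans (ℚ.≤-reflexive (sym pL≡U)) (ℚ.*-monoˡ-≤-nonNeg p {{nonNegative 0≤p}} (toℚ-mono-≤ L≤|A|)))
          where
          L≤|A| : L ≤ length (admissible n r F)
          L≤|A| = ℕ.≤-trans (kernel-stays good (ℕ.<⇒≤ |F|<4+m)) (count-≤-length _ (admissible n r F))
        1≤n : 1 ≤ n
        1≤n = ℕ.≤-trans (s≤s z≤n) (ℕ.≤-trans (ℕ.m≤n+m 9 (6 * r)) 6r+9≤n)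
        1-ε≤1-mp : 1ℚ - ε Q.≤ 1ℚ - toℚ m Q.* p
        1-ε≤1-mp = ℚ.+-monoʳ-≤ 1ℚ (ℚ.neg-antimono-≤
          (mp≤ε {m} {U} {L} {n ^ 3} {384 * r ^ 8} {p} {ε} (ℕ.*-mono-≤ 1≤L (ℕ.^-monoˡ-≤ 3 1≤n)) pL≡U numeric r⁸-small))

    survives : T (isStar F₀) → toℚ (384 * r ^ 8) Q.≤ ε Q.* toℚ (n ^ 3) → 1ℚ - ε Q.≤ runExp n r m F₀ gP
    survives isStar-F₀ = by-cases (4 ℕ.≤? r)
      where
      by-cases : Dec (4 ≤ r) → toℚ (384 * r ^ 8) Q.≤ ε Q.* toℚ (n ^ 3) → 1ℚ - ε Q.≤ runExp n r m F₀ gP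
      -- Fewer than four points: no r-set meets the four members at distinct points.
      by-cases (no r≱4) = survives-with 0 none isStar-F₀ (subst (_≤ 384 * r ^ 8 * L) (sym no-leavers) z≤n)
        where
        none : ∀ {ds} → Unique ds → length ds ≡ 4 → #supersets (λ i → does (i ∈? ds)) r ≤ 0
        none {ds} uds len =
          ℕ.≤-reflexive (#supersets-< (λ i → does (i ∈? ds)) r (subst (r <_) (sym (trans (countFin-∈ uds) len)) (ℕ.≰⇒> r≱4)))
        no-leavers : m * (r ^ 4 * 0) * n ^ 3 ≡ 0
        no-leavers = trans (cong (λ t → m * t * n ^ 3) (ℕ.*-zeroʳ (r ^ 4))) (cong (_* n ^ 3) (ℕ.*-zeroʳ m))
      by-cases (yes 4≤r) = survives-with ((n ∸ 4) C (r ∸ 4)) four isStar-F₀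
        (m[r⁴c]n³≤384r⁸L {n} {r} {m} {(n ∸ 4) C (r ∸ 4)} {G} {L} m≤3r (subst (λ g → ((n ∸ 4) C (r ∸ 4)) * n ^ 3 ≤ 64 * r ^ 3 * g) (sym G≡)
                                     (C[n∸4,r∸4]*n³≤64r³C[n∸1,r∸1] n r 4≤n 4≤r)) G≤2L)
        where
        4≤n : 4 ≤ n
        4≤n = ℕ.≤-trans (ℕ.m≤n+m 4 5) (ℕ.≤-trans (ℕ.m≤n+m 9 (6 * r)) 6r+9≤n)
        four : ∀ {ds} → Unique ds → length ds ≡ 4 → #supersets (λ i → does (i ∈? ds)) r ≤ (n ∸ 4) C (r ∸ 4)
        four {ds} uds len = ℕ.≤-reflexive (trans (#supersets-≥ Dds r (subst (_≤ r) (sym #ds≡4) 4≤r))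
                                            (cong₂ _C_ (trans (countFin-not Dds) (cong (n ∸_) #ds≡4)) (cong (r ∸_) #ds≡4)))
          where
          Dds = λ i → does (i ∈? ds)
          #ds≡4 = trans (countFin-∈ uds) len

  [1-ε]Pr[A₄]≤Pr[A₄∧B] : ∀ n r ε → 6 * r + 9 ≤ n → toℚ (384 * r ^ 8) Q.≤ ε Q.* toℚ (n ^ 3) →
    (1ℚ - ε) Q.* Pr n r 4 A4 Q.≤ Pr n r (4 ⊔ (3 * r)) (λ F → A4 F ∧ B (3 * r) F)
  [1-ε]Pr[A₄]≤Pr[A₄∧B] n r ε 6r+9≤n r⁸-small = begin
    (1ℚ - ε) Q.* Pr n r 4 A4                          ≡⟨ cong ((1ℚ - ε) Q.*_) (runProb≡runExp-𝟙 n r 4 [] A4) ⟩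
    (1ℚ - ε) Q.* runExp n r 4 [] (𝟙 ∘ A4)             ≡⟨ runExp-*ˡ n r 4 [] (1ℚ - ε) (𝟙 ∘ A4) ⟨
    runExp n r 4 [] (λ F → (1ℚ - ε) Q.* 𝟙 (A4 F))     ≤⟨ runExp-mono n r 4 initial pointwise ⟩
    runExp n r 4 [] (λ F → runExp n r m F (𝟙 ∘ P))    ≡⟨ runExp-+ n r 4 m [] (𝟙 ∘ P) ⟨
    runExp n r (4 + m) [] (𝟙 ∘ P)                     ≡⟨ cong (λ k → runExp n r k [] (𝟙 ∘ P)) 4+m≡4⊔3r ⟩
    runExp n r (4 ⊔ (3 * r)) [] (𝟙 ∘ P)               ≡⟨ runProb≡runExp-𝟙 n r (4 ⊔ (3 * r)) [] P ⟨
    Pr n r (4 ⊔ (3 * r)) P                            ∎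
    where
    open ℚ.≤-Reasoning
    P : List (Subset n) → Bool
    P F = A4 F ∧ B (3 * r) F
    m = (4 ⊔ (3 * r)) ∸ 4
    4+m≡4⊔3r : 4 + m ≡ 4 ⊔ (3 * r)
    4+m≡4⊔3r = ℕ.m+[n∸m]≡n (ℕ.m≤m⊔n 4 (3 * r))
    m≤3r : m ≤ 3 * r
    m≤3r = ℕ.m≤n+o⇒m∸n≤o (4 ⊔ (3 * r)) 4 (ℕ.⊔-lub (ℕ.m≤m+n 4 (3 * r)) (ℕ.m≤n+m (3 * r) 4))
    pointwise : ∀ {F} → Reachable n r F → length F ≡ 0 + 4 → (1ℚ - ε) Q.* 𝟙 (A4 F) Q.≤ runExp n r m F (𝟙 ∘ P)
    pointwise {[]} _ ()
    pointwise {_ ∷ []} _ ()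
    pointwise {_ ∷ _ ∷ []} _ ()
    pointwise {_ ∷ _ ∷ _ ∷ []} _ ()
    pointwise {_ ∷ _ ∷ _ ∷ _ ∷ _ ∷ _} _ ()
    pointwise {F₀@(S₁ ∷ S₂ ∷ S₃ ∷ S₄ ∷ [])} reach refl = by-cases (T? (isStar F₀))
      where
      by-cases : Dec (T (isStar F₀)) → (1ℚ - ε) Q.* 𝟙 (isStar F₀) Q.≤ runExp n r m F₀ (𝟙 ∘ P)
      by-cases (no ¬star) = ℚ.≤-trans (ℚ.≤-reflexive (trans (cong (λ b → (1ℚ - ε) Q.* 𝟙 b) (dec-false (T? (isStar F₀)) ¬star)) (ℚ.*-zeroʳ (1ℚ - ε))))
                                      (runExp-nonNeg n r m F₀ (λ F → 𝟙-nonNeg (P F)))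
      by-cases (yes star) = ℚ.≤-trans (ℚ.≤-reflexive (trans (cong ((1ℚ - ε) Q.*_) (𝟙-true star)) (ℚ.*-identityʳ (1ℚ - ε))))
        (KernelSurvival.survives n r m ε m≤3r 6r+9≤n (proj₂ (isStar⇒Star F₀ star)) (Reachable⇒sizes n r reach) S₁≢S₂ star r⁸-small)
        where
        S₁≢S₂ : S₁ ≢ S₂
        S₁≢S₂ = All-head (AllPairs.head (Reachable⇒Unique n r reach))


open import Defs
open import Data.Nat using (ℕ; _≤_; _⊔_; _*_; _^_)
open import Data.Bool using (_∧_)
open import Data.Product using (Σ; _×_)
open import Data.Rational using (ℚ; 0ℚ; 1ℚ; _<_; _-_)
import Data.Rational as Q

import Data.Integer as ℤ
open import Data.Nat using (_+_)
import Data.Nat.Properties as ℕ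
open import Data.Product using (_,_; proj₁; proj₂)
import Data.Rational.Properties as ℚ
open import Data.Rational.Solver using (module +-*-Solver)
open import Relation.Binary.PropositionalEquality using (_≡_; refl; sym; trans; cong; subst)

open Averaging using (toℚ-*; toℚ-cancel-≤; /-*-cancel)
open Binomials using (r⁸≤n³⇒r²≤n; 6r+9≤n)
open Kernel using ([1-ε]Pr[A₄]≤Pr[A₄∧B])

lemma5 : (r : ℕ → ℕ) → (∀ n → 1 ≤ r n)
    → (∀ (δ : ℚ) → 0ℚ < δ → Σ ℕ λ N → ∀ n → N ≤ n → toℚ (r n ^ 8) Q.≤ δ Q.* toℚ (n ^ 3))
    → ∀ (ε : ℚ) → 0ℚ < ε → Σ ℕ λ N → ∀ n → N ≤ n →
        (1ℚ - ε) Q.* Pr n (r n) 4 A4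
          Q.≤ Pr n (r n) (4 ⊔ (3 * r n)) (λ F → A4 F ∧ B (3 * r n) F)
lemma5 r _ r⁸=o[n³] ε 0<ε = N , λ n N≤n →
  [1-ε]Pr[A₄]≤Pr[A₄∧B] n (r n) ε (n-large n N≤n) (r⁸-small n N≤n)
  where
  δ : ℚ
  δ = ((ℤ.+ 1) Q./ 384) Q.* ε
  384δ≡ε : toℚ 384 Q.* δ ≡ ε
  384δ≡ε = trans (solve 3 (λ k i e → k :* (i :* e) := (i :* k) :* e) refl (toℚ 384) ((ℤ.+ 1) Q./ 384) ε)
                 (trans (cong (Q._* ε) (/-*-cancel 1 383)) (ℚ.*-identityˡ ε))
    where open +-*-Solver
  r⁸≤n³ = r⁸=o[n³] 1ℚ (ℚ.positive⁻¹ 1ℚ)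
  r⁸≤δn³ = r⁸=o[n³] δ (subst (_< δ) (ℚ.*-zeroʳ ((ℤ.+ 1) Q./ 384)) (ℚ.*-monoʳ-<-pos ((ℤ.+ 1) Q./ 384) {{ℚ.normalize-pos 1 384}} 0<ε))
  N : ℕ
  N = (proj₁ r⁸≤n³ ⊔ proj₁ r⁸≤δn³) ⊔ 100
  N₁≤ : ∀ {n} → N ≤ n → proj₁ r⁸≤n³ ≤ n
  N₁≤ N≤n = ℕ.≤-trans (ℕ.≤-trans (ℕ.m≤m⊔n _ _) (ℕ.m≤m⊔n _ 100)) N≤n
  N₂≤ : ∀ {n} → N ≤ n → proj₁ r⁸≤δn³ ≤ n
  N₂≤ N≤n = ℕ.≤-trans (ℕ.≤-trans (ℕ.m≤n⊔m (proj₁ r⁸≤n³) _) (ℕ.m≤m⊔n _ 100)) N≤n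
  n-large : ∀ n → N ≤ n → 6 * r n + 9 ≤ n
  n-large n N≤n = 6r+9≤n n (r n) (ℕ.≤-trans (ℕ.m≤n⊔m _ 100) N≤n)
    (r⁸≤n³⇒r²≤n n (r n) (toℚ-cancel-≤ (subst (toℚ (r n ^ 8) Q.≤_) (ℚ.*-identityˡ _) (proj₂ r⁸≤n³ n (N₁≤ N≤n)))))
  r⁸-small : ∀ n → N ≤ n → toℚ (384 * r n ^ 8) Q.≤ ε Q.* toℚ (n ^ 3)
  r⁸-small n N≤n = ℚ.≤-trans (ℚ.≤-reflexive (toℚ-* 384 (r n ^ 8)))
    (ℚ.≤-trans (ℚ.*-monoˡ-≤-nonNeg (toℚ 384) {{_}} (proj₂ r⁸≤δn³ n (N₂≤ N≤n)))
               (ℚ.≤-reflexive (trans (sym (ℚ.*-assoc (toℚ 384) δ (toℚ (n ^ 3)))) (cong (Q._* toℚ (n ^ 3)) 384δ≡ε))))
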